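{- Let $\pi=(d_1,\dots,d_n)$ be the degree sequence of a tree with $d_1\ge\cdots\ge d_k\ge 2$, $d_{k+1}=\cdots=d_n=1$, and let $T=C(y_1,\dots,y_k)\in\mathcal{C}_\pi$ with spine $v_0v_1\cdots v_{k+1}$. Suppose there exist an integer $p$ with $1\le p\le k-1$ and a nonnegative integer $q\le\min\{k-p-1,\,p-1\}$ such that $f_{V_{p-i}}(v_{p-i})\ge f_{V_{p+i+1}}(v_{p+i+1})$ for all $i=0,1,\dots,q$, with at least one of these inequalities strict, and $f_{V_{\le p-q-1}}(v_{p-q-1})> f_{V_{\ge p+q+2}}(v_{p+q+2})$. Then there exists a caterpillar $T_1\in\mathcal{C}_\pi$ with $\varphi(T_1)<\varphi(T)$.
   Context: A subtree of a tree is a nonempty connected subgraph; $\varphi(T)$ is the number of nonempty subtrees of $T$, and for a tree $H$ and a vertex $v$ of $H$, $f_H(v)$ is the number of subtrees of $H$ containing $v$. A caterpillar is a tree containing a path such that every vertex not on the path is adjacent to a vertex on the path. $\mathcal{C}_\pi$ is the set of caterpillars with degree sequence $\pi$. For a permutation $(y_1,\dots,y_k)$ of $(d_1-2,\dots,d_k-2)$, $C(y_1,\dots,y_k)$ is the caterpillar obtained from a path $v_0v_1\cdots v_kv_{k+1}$ by attaching $y_j$ new pendant vertices to $v_j$ for $j=1,\dots,k$ (the path is called the spine); every member of $\mathcal{C}_\pi$ is of this form. For $1\le j\le k$: $V_j$ is the component containing $v_j$ of $C(y_1,\dots,y_k)$ minus the two edges $v_{j-1}v_j$ and $v_jv_{j+1}$;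 $V_{\ge j}$ is the component containing $v_j$ after deleting the edge $v_{j-1}v_j$; $V_{\le j}$ is the component containing $v_j$ after deleting the edge $v_jv_{j+1}$. By convention $V_0=V_{\le 0}=\{v_0\}$ and $V_{k+1}=V_{\ge k+1}=\{v_{k+1}\}$ (single-vertex trees). -}

module Defs where

open import Data.Nat using (ℕ; zero; suc; _+_; _∸_; _≡ᵇ_)
open import Data.Bool using (Bool; true; false; _∧_; _∨_; not; if_then_else_)
open import Data.List using (List; []; _∷_; _++_; map; length; upTo; concatMap)
open import Data.Bool.ListAction using (all; any)
open import Data.Product using (_×_; _,_)

Vtx : Set
Vtx = ℕ × ℕ

eqV : Vtx → Vtx → Bool
eqV (a , b) (c , d) = (a ≡ᵇ c) ∧ (b ≡ᵇ d)

_∈ᵇ_ : Vtx → List Vtx → Bool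
v ∈ᵇ S = any (eqV v) S

Adj : Set
Adj = Vtx → Vtx → Bool

filterB : {A : Set} → (A → Bool) → List A → List A
filterB p [] = []
filterB p (x ∷ xs) = if p x then x ∷ filterB p xs else filterB p xs

countB : {A : Set} → (A → Bool) → List A → ℕ
countB p xs = length (filterB p xs)

iter : {A : Set} → ℕ → (A → A) → A → A
iter zero f a = a
iter (suc n) f a = f (iter n f a)

expand : Adj → List Vtx → List Vtx → List Vtx
expand adj S R = filterB (λ w → (w ∈ᵇ R) ∨ any (λ u → adj u w) R) S

-- vertices of S reachable from u by a walk inside S
-- (walks of length < |S| suffice, so |S| expansion steps reach everything)
reach : Adj → List Vtx → Vtx → List Vtx
reach adj S u = iter (length S) (expand adj S) (u ∷ [])

connected : Adj → List Vtx → Bool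
connected adj S = all (λ u → all (λ w → w ∈ᵇ reach adj S u) S) S

nonempty : {A : Set} → List A → Bool
nonempty [] = false
nonempty (_ ∷ _) = true

-- all sub-lists (= subsets, for a duplicate-free vertex list)
subs : {A : Set} → List A → List (List A)
subs [] = [] ∷ []
subs (x ∷ xs) = map (x ∷_) (subs xs) ++ subs xs

-- In a tree, subtrees (nonempty connected subgraphs) correspond exactly to
-- nonempty vertex subsets inducing a connected subgraph.
-- φ(T): number of subtrees of the tree (verts, adj)
φ : List Vtx → Adj → ℕ
φ verts adj = countB (λ S → nonempty S ∧ connected adj S) (subs verts)

fH : List Vtx → Adj → Vtx → ℕ
fH verts adj v = countB (λ S → (v ∈ᵇ S) ∧ connected adj S) (subs verts)

deleteEdges : Adj → List (Vtx × Vtx) → Adj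
deleteEdges adj es u w =
  adj u w ∧ not (any (λ { (a , b) → (eqV u a ∧ eqV w b) ∨ (eqV u b ∧ eqV w a) }) es)

component : List Vtx → Adj → Vtx → List Vtx
component verts adj v = reach adj verts v

-- Caterpillars C(y₁,…,y_k).  ys = (y₁,…,y_k), k = length ys.
-- Encoding: spine vertex v_i is (i , 0) for 0 ≤ i ≤ k+1;
-- the t-th pendant vertex attached to v_j is (j , suc t), t < y_j.

-- y_i, with the convention y_0 = y_{k+1} = 0 (no pendant vertices at v_0, v_{k+1})
yAt : List ℕ → ℕ → ℕ
yAt ys zero = 0
yAt [] (suc i) = 0
yAt (y ∷ ys) (suc zero) = y
yAt (y ∷ ys) (suc (suc i)) = yAt ys (suc i)

sp : ℕ → Vtx
sp i = (i , 0)

catVerts : List ℕ → List Vtx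
catVerts ys =
  concatMap (λ i → (i , 0) ∷ map (λ t → (i , suc t)) (upTo (yAt ys i)))
            (upTo (suc (suc (length ys))))

catAdj : List ℕ → Adj
catAdj ys (i , zero) (j , zero) = (suc i ≡ᵇ j) ∨ (suc j ≡ᵇ i)
catAdj ys (i , zero) (j , suc _) = i ≡ᵇ j
catAdj ys (i , suc _) (j , zero) = i ≡ᵇ j
catAdj ys (i , suc _) (j , suc _) = false

φCat : List ℕ → ℕ
φCat ys = φ (catVerts ys) (catAdj ys)

fComp : List ℕ → List (Vtx × Vtx) → ℕ → ℕ
fComp ys es j =
  let adj' = deleteEdges (catAdj ys) es
  in fH (component (catVerts ys) adj' (sp j)) adj' (sp j)

-- f_{V_j}(v_j): delete v_{j-1}v_j and v_j v_{j+1}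
-- (for j = 0 the pair (v_0,v_0) is not an edge, so V_0 = {v_0} as required)
fV : List ℕ → ℕ → ℕ
fV ys j = fComp ys ((sp (j ∸ 1) , sp j) ∷ (sp j , sp (suc j)) ∷ []) j

fV≥ : List ℕ → ℕ → ℕ
fV≥ ys j = fComp ys ((sp (j ∸ 1) , sp j) ∷ []) j

fV≤ : List ℕ → ℕ → ℕ
fV≤ ys j = fComp ys ((sp j , sp (suc j)) ∷ []) j

-- Write C(y₁,…,y_k) through its pendant counts z₀ = 0, z₁ = y₁, …, z_k = y_k, z_{k+1} = 0.
-- A subtree is either a single pendant vertex or meets the spine in an interval, around
-- which it may contain any set of pendant vertices.  Hence the numbers of subtrees of a
-- spine segment through its first vertex, its last vertex, both, and in total obey simple
-- product recursions, f_{V_j}(v_j) = 2^{y_j}, and f_{V≥j}(v_j), f_{V≤j}(v_j) are such counts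
-- for the two end segments.  Cut the spine into P M Q with M = v_{p−q} … v_{p+q+1} and
-- reverse M: this keeps the degree sequence and changes φ by
--   (f_last(P) − f_first(Q)) (f_first(M) − f_last(M)).
-- The first factor is positive by the last hypothesis, the second by peeling M from the
-- outside in, one pair (v_{p−i}, v_{p+i+1}) at a time.

module Submission where

open import Defs
open import Data.Bool using (Bool; true; false; _∧_; _∨_; not; if_then_else_)
open import Data.Bool.ListAction using (all; any)
open import Data.Bool.Properties using (¬-not; T-≡; ∨-zeroʳ; ∧-zeroʳ; ∧-assoc; ∧-comm; ∧-identityʳ)
open import Data.Empty using (⊥; ⊥-elim)
open import Data.List using (List; []; _∷_; _++_; map; length; null; upTo; applyUpTo; concatMap; reverse)
open import Data.List.Membership.Propositional using (_∈_; _∉_)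
open import Data.List.Membership.Propositional.Properties using (∈-++⁻; ∈-++⁺ʳ; ∈-map⁻)
open import Data.List.Properties using (length-++; map-++; map-∘; length-map; length-upTo; ++-assoc; ++-identityʳ; unfold-reverse; reverse-involutive)
open import Data.List.Relation.Binary.Permutation.Propositional using (_↭_; ↭-trans)
open import Data.List.Relation.Binary.Permutation.Propositional.Properties using (↭-reverse; ++⁺ˡ; ++⁺ʳ; ↭-length)
open import Data.List.Relation.Unary.All using (All)
open import Data.List.Relation.Unary.All.Properties using (All¬⇒¬Any)
open import Data.List.Relation.Unary.AllPairs using (_∷_)
open import Data.List.Relation.Unary.Any using (here; there)
open import Data.List.Relation.Unary.Linked using (Linked)
open import Data.List.Relation.Unary.Unique.Propositional using (Unique)
open import Data.List.Relation.Unary.Unique.Propositional.Properties using (map⁺; upTo⁺)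
open import Data.Nat using (ℕ; zero; suc; _+_; _≤_; _<_; z≤n; s≤s; _≡ᵇ_; _≤ᵇ_; _∸_; _*_; _^_)
open import Data.Nat.ListAction using (sum)
open import Data.Nat.ListAction.Properties using (sum-++)
open import Data.Nat.Properties
open import Data.Nat.Tactic.RingSolver using (solve-∀)
open import Data.Product using (∃; _×_; _,_; proj₁; proj₂; Σ)
open import Data.Sum using (_⊎_; inj₁; inj₂; [_,_]′)
open import Function using (_∘_; Equivalence; id)
open import Relation.Binary.PropositionalEquality

false≢true : false ≢ true
false≢true ()

∧-true⁻ : ∀ {a b} → a ∧ b ≡ true → a ≡ true × b ≡ true
∧-true⁻ {true} {true} _ = refl , refl

∨-true⁻ : ∀ {a b} → a ∨ b ≡ true → a ≡ true ⊎ b ≡ true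
∨-true⁻ {true} _ = inj₁ refl
∨-true⁻ {false} e = inj₂ e

Bool-ext : ∀ {a b} → (a ≡ true → b ≡ true) → (b ≡ true → a ≡ true) → a ≡ b
Bool-ext {true} f _ = sym (f refl)
Bool-ext {false} {true} _ g = g refl
Bool-ext {false} {false} _ _ = refl

≡ᵇ-refl : ∀ n → (n ≡ᵇ n) ≡ true
≡ᵇ-refl n = Equivalence.to T-≡ (≡⇒≡ᵇ n n refl)

≡ᵇ-true⇒≡ : ∀ m n → (m ≡ᵇ n) ≡ true → m ≡ n
≡ᵇ-true⇒≡ m n e = ≡ᵇ⇒≡ m n (Equivalence.from T-≡ e)

≢⇒≡ᵇ-false : ∀ m n → m ≢ n → (m ≡ᵇ n) ≡ false
≢⇒≡ᵇ-false m n m≢n = ¬-not (m≢n ∘ ≡ᵇ-true⇒≡ m n)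

≤ᵇ-true⁺ : ∀ m n → m ≤ n → (m ≤ᵇ n) ≡ true
≤ᵇ-true⁺ m n m≤n = Equivalence.to T-≡ (≤⇒≤ᵇ m≤n)

≤ᵇ-true⁻ : ∀ m n → (m ≤ᵇ n) ≡ true → m ≤ n
≤ᵇ-true⁻ m n e = ≤ᵇ⇒≤ m n (Equivalence.from T-≡ e)

≤ᵇ-false⁺ : ∀ m n → n < m → (m ≤ᵇ n) ≡ false
≤ᵇ-false⁺ m n n<m = ¬-not (<⇒≱ n<m ∘ ≤ᵇ-true⁻ m n)

≤ᵇ-false⁻ : ∀ m n → (m ≤ᵇ n) ≡ false → n < m
≤ᵇ-false⁻ m n e = ≰⇒> λ m≤n → false≢true (trans (sym e) (≤ᵇ-true⁺ m n m≤n))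

eqV-refl : ∀ v → eqV v v ≡ true
eqV-refl (a , b) rewrite ≡ᵇ-refl a | ≡ᵇ-refl b = refl

eqV-true⇒≡ : ∀ u v → eqV u v ≡ true → u ≡ v
eqV-true⇒≡ (a , b) (c , d) e with ∧-true⁻ {a ≡ᵇ c} e
... | e₁ , e₂ = cong₂ _,_ (≡ᵇ-true⇒≡ a c e₁) (≡ᵇ-true⇒≡ b d e₂)

module _ {A : Set} (p : A → Bool) where

  any-true⁻ : ∀ xs → any p xs ≡ true → ∃ λ x → x ∈ xs × p x ≡ true
  any-true⁻ (x ∷ xs) e with ∨-true⁻ {p x} e
  ... | inj₁ px = x , here refl , px
  ... | inj₂ e′ with any-true⁻ xs e′
  ... | y , y∈xs , py = y , there y∈xs , py

  any-true⁺ : ∀ {xs x} → x ∈ xs → p x ≡ true → any p xs ≡ true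
  any-true⁺ (here refl) px rewrite px = refl
  any-true⁺ {y ∷ _} (there x∈xs) px rewrite any-true⁺ x∈xs px with p y
  ... | true = refl
  ... | false = refl

  all-true⁻ : ∀ xs → all p xs ≡ true → ∀ x → x ∈ xs → p x ≡ true
  all-true⁻ (y ∷ xs) e x (here refl) = proj₁ (∧-true⁻ {p y} e)
  all-true⁻ (y ∷ xs) e x (there x∈xs) = all-true⁻ xs (proj₂ (∧-true⁻ {p y} e)) x x∈xs

  all-true⁺ : ∀ xs → (∀ x → x ∈ xs → p x ≡ true) → all p xs ≡ true
  all-true⁺ [] _ = refl
  all-true⁺ (y ∷ xs) h rewrite h y (here refl) = all-true⁺ xs (λ x → h x ∘ there)

module _ {A : Set} where

  any-cong : ∀ (p q : A → Bool) xs → (∀ x → x ∈ xs → p x ≡ q x) → any p xs ≡ any q xs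
  any-cong p q [] h = refl
  any-cong p q (y ∷ xs) h rewrite h y (here refl) | any-cong p q xs (λ x → h x ∘ there) = refl

  all-cong : ∀ (p q : A → Bool) xs → (∀ x → x ∈ xs → p x ≡ q x) → all p xs ≡ all q xs
  all-cong p q [] h = refl
  all-cong p q (y ∷ xs) h rewrite h y (here refl) | all-cong p q xs (λ x → h x ∘ there) = refl

∈ᵇ⇒∈ : ∀ v S → v ∈ᵇ S ≡ true → v ∈ S
∈ᵇ⇒∈ v S e with any-true⁻ (eqV v) S e
... | x , x∈S , v≈x rewrite eqV-true⇒≡ v x v≈x = x∈S

∈⇒∈ᵇ : ∀ {v S} → v ∈ S → v ∈ᵇ S ≡ true
∈⇒∈ᵇ {v} v∈S = any-true⁺ (eqV v) v∈S (eqV-refl v)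

∈ᵇ-head : ∀ v L → v ∈ᵇ (v ∷ L) ≡ true
∈ᵇ-head v L = ∈⇒∈ᵇ {v} {v ∷ L} (here refl)

∉⇒∈ᵇ-false : ∀ {v S} → v ∉ S → v ∈ᵇ S ≡ false
∉⇒∈ᵇ-false {v} {S} v∉S = ¬-not (v∉S ∘ ∈ᵇ⇒∈ v S)

∈ᵇ-false⇒∉ : ∀ {v S} → v ∈ᵇ S ≡ false → v ∉ S
∈ᵇ-false⇒∉ e v∈S with trans (sym e) (∈⇒∈ᵇ v∈S)
... | ()

module _ {A : Set} (p : A → Bool) where

  filterB-∈⁻ : ∀ {x} xs → x ∈ filterB p xs → x ∈ xs × p x ≡ true
  filterB-∈⁻ (y ∷ xs) x∈ with p y in py
  filterB-∈⁻ (y ∷ xs) (here refl) | true = here refl , py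
  filterB-∈⁻ (y ∷ xs) (there x∈) | true = let (x∈xs , px) = filterB-∈⁻ xs x∈ in there x∈xs , px
  filterB-∈⁻ (y ∷ xs) x∈ | false = let (x∈xs , px) = filterB-∈⁻ xs x∈ in there x∈xs , px

  filterB-∈⁺ : ∀ {x} xs → x ∈ xs → p x ≡ true → x ∈ filterB p xs
  filterB-∈⁺ (y ∷ xs) (here refl) px rewrite px = here refl
  filterB-∈⁺ (y ∷ xs) (there x∈xs) px with p y
  ... | true = there (filterB-∈⁺ xs x∈xs px)
  ... | false = filterB-∈⁺ xs x∈xs px

  filterB-all : ∀ xs → (∀ x → x ∈ xs → p x ≡ true) → filterB p xs ≡ xs
  filterB-all [] h = refl
  filterB-all (y ∷ xs) h rewrite h y (here refl) = cong (y ∷_) (filterB-all xs (λ x → h x ∘ there))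

  filterB-none : ∀ xs → (∀ x → x ∈ xs → p x ≡ false) → filterB p xs ≡ []
  filterB-none [] h = refl
  filterB-none (y ∷ xs) h rewrite h y (here refl) = filterB-none xs (λ x → h x ∘ there)

  filterB-++ : ∀ xs ys → filterB p (xs ++ ys) ≡ filterB p xs ++ filterB p ys
  filterB-++ [] ys = refl
  filterB-++ (x ∷ xs) ys with p x
  ... | true = cong (x ∷_) (filterB-++ xs ys)
  ... | false = filterB-++ xs ys

  countB-++ : ∀ xs ys → countB p (xs ++ ys) ≡ countB p xs + countB p ys
  countB-++ xs ys = trans (cong length (filterB-++ xs ys)) (length-++ (filterB p xs))

  countB≤length : ∀ xs → countB p xs ≤ length xs
  countB≤length [] = z≤n
  countB≤length (x ∷ xs) with p x
  ... | true = s≤s (countB≤length xs)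
  ... | false = m≤n⇒m≤1+n (countB≤length xs)

  countB-none : ∀ xs → (∀ x → x ∈ xs → p x ≡ false) → countB p xs ≡ 0
  countB-none xs h = cong length (filterB-none xs h)

  countB-pos : ∀ {x} xs → x ∈ xs → p x ≡ true → 1 ≤ countB p xs
  countB-pos (y ∷ xs) (here refl) px rewrite px = s≤s z≤n
  countB-pos (y ∷ xs) (there x∈xs) px with p y
  ... | true = s≤s z≤n
  ... | false = countB-pos xs x∈xs px

module _ {A : Set} where

  filterB-cong : ∀ (p q : A → Bool) xs → (∀ x → x ∈ xs → p x ≡ q x) → filterB p xs ≡ filterB q xs
  filterB-cong p q [] h = refl
  filterB-cong p q (y ∷ xs) h rewrite h y (here refl) | filterB-cong p q xs (λ x → h x ∘ there) = refl

  countB-cong : ∀ (p q : A → Bool) xs → (∀ x → x ∈ xs → p x ≡ q x) → countB p xs ≡ countB q xs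
  countB-cong p q xs h = cong length (filterB-cong p q xs h)

  countB-map : ∀ {B : Set} (p : B → Bool) (f : A → B) xs → countB p (map f xs) ≡ countB (p ∘ f) xs
  countB-map p f [] = refl
  countB-map p f (x ∷ xs) with p (f x)
  ... | true = cong suc (countB-map p f xs)
  ... | false = countB-map p f xs

  countB-∨ : ∀ (p q : A → Bool) xs → (∀ x → x ∈ xs → p x ∧ q x ≡ false) →
    countB (λ x → p x ∨ q x) xs ≡ countB p xs + countB q xs
  countB-∨ p q [] h = refl
  countB-∨ p q (x ∷ xs) h with p x in px | q x in qx | countB-∨ p q xs (λ y → h y ∘ there)
  ... | true | true | _ with trans (sym (h x (here refl))) (cong₂ _∧_ px qx)
  ...   | ()
  countB-∨ p q (x ∷ xs) h | true | false | ih = cong suc ih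
  countB-∨ p q (x ∷ xs) h | false | true | ih = trans (cong suc ih) (sym (+-suc _ _))
  countB-∨ p q (x ∷ xs) h | false | false | ih = ih

pos : Vtx → ℕ
pos = proj₁

ball : Adj → List Vtx → Vtx → ℕ → List Vtx
ball adj S u n = iter n (expand adj S) (u ∷ [])

module _ (adj : Adj) (S : List Vtx) (u : Vtx) where

  ball-closed : (C : Vtx → Set) → C u → (∀ c w → C c → w ∈ S → adj c w ≡ true → C w) →
    ∀ n x → x ∈ ball adj S u n → C x
  ball-closed C Cu closed zero x (here refl) = Cu
  ball-closed C Cu closed (suc n) x x∈ with filterB-∈⁻ _ S x∈
  ... | x∈S , reached with ∨-true⁻ {x ∈ᵇ ball adj S u n} reached
  ... | inj₁ old = ball-closed C Cu closed n x (∈ᵇ⇒∈ x _ old)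
  ... | inj₂ new with any-true⁻ (λ c → adj c x) (ball adj S u n) new
  ... | c , c∈ , c~x = closed c x (ball-closed C Cu closed n c c∈) x∈S c~x

  ball-step : ∀ n {x w} → x ∈ ball adj S u n → w ∈ S → adj x w ≡ true → w ∈ ball adj S u (suc n)
  ball-step n {x} {w} x∈ w∈S x~w = filterB-∈⁺ _ S w∈S
    (trans (cong ((w ∈ᵇ ball adj S u n) ∨_) (any-true⁺ (λ c → adj c w) x∈ x~w)) (∨-zeroʳ _))

  ball-mono : ∀ n m {x} → n ≤ m → x ∈ ball adj S u n → x ∈ S → x ∈ ball adj S u m
  ball-mono n m {x} n≤m x∈ x∈S =
    subst (λ k → x ∈ ball adj S u k) (m∸n+n≡m n≤m) (grow (m ∸ n))
    where
    grow : ∀ k → x ∈ ball adj S u (k + n)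
    grow zero = x∈
    grow (suc k) = filterB-∈⁺ _ S x∈S
      (cong (_∨ any (λ c → adj c x) (ball adj S u (k + n))) (∈⇒∈ᵇ (grow k)))

  ball⊆ : u ∈ S → ∀ n x → x ∈ ball adj S u n → x ∈ S
  ball⊆ u∈S zero x (here refl) = u∈S
  ball⊆ u∈S (suc n) x x∈ = proj₁ (filterB-∈⁻ _ S x∈)

  ball≡filterB : ∀ n (P : Vtx → Bool) →
    (∀ w → w ∈ S → w ∈ ball adj S u (suc n) → P w ≡ true) →
    (∀ w → w ∈ S → P w ≡ true → w ∈ ball adj S u (suc n)) →
    ball adj S u (suc n) ≡ filterB P S
  ball≡filterB n P sound complete = filterB-cong _ P S λ w w∈S →
    Bool-ext (λ reached → sound w w∈S (filterB-∈⁺ _ S w∈S reached))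
             (λ Pw → proj₂ (filterB-∈⁻ _ S (complete w w∈S Pw)))

  ball-cong : ∀ adj′ → u ∈ S → (∀ a b → a ∈ S → b ∈ S → adj a b ≡ adj′ a b) →
    ∀ n → ball adj S u n ≡ ball adj′ S u n
  ball-cong adj′ u∈S same zero = refl
  ball-cong adj′ u∈S same (suc n) =
    trans (filterB-cong _ _ S (λ w w∈S → cong ((w ∈ᵇ ball adj S u n) ∨_)
             (any-cong (λ c → adj c w) (λ c → adj′ c w) (ball adj S u n)
                (λ c c∈ → same c w (ball⊆ u∈S n c c∈) w∈S))))
          (cong (expand adj′ S) (ball-cong adj′ u∈S same n))

connected⇒ball : ∀ adj S → connected adj S ≡ true →
  ∀ u w → u ∈ S → w ∈ S → w ∈ ball adj S u (length S)
connected⇒ball adj S conn u w u∈S w∈S =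
  ∈ᵇ⇒∈ w _ (all-true⁻ (λ w → w ∈ᵇ reach adj S u) S (all-true⁻ _ S conn u u∈S) w w∈S)

ball⇒connected : ∀ adj S → (∀ u w → u ∈ S → w ∈ S → w ∈ ball adj S u (length S)) →
  connected adj S ≡ true
ball⇒connected adj S reached =
  all-true⁺ _ S (λ u u∈S → all-true⁺ _ S (λ w w∈S → ∈⇒∈ᵇ (reached u w u∈S w∈S)))

connected-cong : ∀ adj adj′ S → (∀ a b → a ∈ S → b ∈ S → adj a b ≡ adj′ a b) →
  connected adj S ≡ connected adj′ S
connected-cong adj adj′ S same = all-cong _ _ S (λ u u∈S → all-cong _ _ S (λ w _ →
  cong (w ∈ᵇ_) (ball-cong adj S u adj′ u∈S same (length S))))

onSegment : ℕ → ℕ → Vtx → Bool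
onSegment a zero v = false
onSegment a (suc n) v = onSegment a n v ∨ eqV v (a + n , 0)

onSegment-true⁻ : ∀ a n v → onSegment a n v ≡ true → pos v < a + n × proj₂ v ≡ 0
onSegment-true⁻ a (suc n) v e with ∨-true⁻ {onSegment a n v} e
... | inj₁ e′ = let (v<a+n , spine) = onSegment-true⁻ a n v e′ in
                <-≤-trans v<a+n (+-monoʳ-≤ a (n≤1+n n)) , spine
... | inj₂ e′ rewrite eqV-true⇒≡ v _ e′ = +-monoʳ-< a (n<1+n n) , refl

onSegment-excludes : ∀ a n x → (pos x < a + n → proj₂ x ≢ 0) →
  ∀ v → onSegment a n v ∧ eqV v x ≡ false
onSegment-excludes a n x apart v = ¬-not λ both →
  let (on , v≡x) = ∧-true⁻ {onSegment a n v} both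
      (v<a+n , spine) = onSegment-true⁻ a n v on
  in apart (subst (λ y → pos y < a + n) (eqV-true⇒≡ v x v≡x) v<a+n)
           (subst (λ y → proj₂ y ≡ 0) (eqV-true⇒≡ v x v≡x) spine)

segment≤countB : ∀ a n S → (∀ m → m < n → (a + m , 0) ∈ S) → n ≤ countB (onSegment a n) S
segment≤countB a zero S _ = z≤n
segment≤countB a (suc n) S seg
  rewrite countB-∨ (onSegment a n) (λ v → eqV v (a + n , 0)) S
            (λ v _ → onSegment-excludes a n (a + n , 0) (λ lt _ → <-irrefl refl lt) v)
  = subst (_≤ countB (onSegment a n) S + countB (λ v → eqV v (a + n , 0)) S) (+-comm n 1)
      (+-mono-≤ (segment≤countB a n S (λ m → seg m ∘ m<n⇒m<1+n))
                (countB-pos (λ v → eqV v (a + n , 0)) S (seg n (n<1+n n)) (eqV-refl (a + n , 0))))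

segment≤length : ∀ a n S → (∀ m → m < n → (a + m , 0) ∈ S) → n ≤ length S
segment≤length a n S seg = ≤-trans (segment≤countB a n S seg) (countB≤length _ S)

segment+leaf≤length : ∀ a n S x → (∀ m → m < n → (a + m , 0) ∈ S) → x ∈ S → proj₂ x ≢ 0 →
  suc n ≤ length S
segment+leaf≤length a n S x seg x∈S leaf =
  ≤-trans (subst (_≤ countB (λ v → onSegment a n v ∨ eqV v x) S) (+-comm n 1)
             (subst (n + 1 ≤_) (sym (countB-∨ (onSegment a n) (λ v → eqV v x) S
                                       (λ v _ → onSegment-excludes a n x (λ _ → leaf) v)))
               (+-mono-≤ (segment≤countB a n S seg) (countB-pos (λ v → eqV v x) S x∈S (eqV-refl x)))))
          (countB≤length _ S)

module SpineWalk (adj : Adj) (S : List Vtx) (C : ℕ → Set)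
  (C-convex : ∀ a m b → C a → C b → a ≤ m → m ≤ b → C m)
  (C⇒∈ : ∀ m → C m → (m , 0) ∈ S)
  (C⇒linked : ∀ m → C m → C (suc m) →
              adj (m , 0) (suc m , 0) ≡ true × adj (suc m , 0) (m , 0) ≡ true)
  where

  private
    inner : ∀ a d → C a → C (a + suc d) → C (suc (a + d)) × C (a + d)
    inner a d Ca Cend =
      subst C (+-suc a d) Cend ,
      C-convex a (a + d) (a + suc d) Ca Cend (m≤m+n a d) (+-monoʳ-≤ a (n≤1+n d))

  walk-up : ∀ u n a d → C a → C (a + d) → (a , 0) ∈ ball adj S u n →
    (a + d , 0) ∈ ball adj S u (d + n)
  walk-up u n a zero _ _ a∈ rewrite +-identityʳ a = a∈
  walk-up u n a (suc d) Ca Cend a∈ =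
    let (Cnext , Cmid) = inner a d Ca Cend in
    subst (λ x → (x , 0) ∈ ball adj S u (suc d + n)) (sym (+-suc a d))
      (ball-step adj S u (d + n) (walk-up u n a d Ca Cmid a∈) (C⇒∈ _ Cnext)
         (proj₁ (C⇒linked _ Cmid Cnext)))

  walk-down : ∀ u n a d → C a → C (a + d) → (a + d , 0) ∈ ball adj S u n →
    (a , 0) ∈ ball adj S u (d + n)
  walk-down u n a zero _ _ a∈ rewrite +-identityʳ a = a∈
  walk-down u n a (suc d) Ca Cend end∈ =
    let (Cnext , Cmid) = inner a d Ca Cend in
    subst (λ k → (a , 0) ∈ ball adj S u k) (+-suc d n)
      (walk-down u (suc n) a d Ca Cmid
         (ball-step adj S u n (subst (λ x → (x , 0) ∈ ball adj S u n) (+-suc a d) end∈)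
            (C⇒∈ _ Cmid) (proj₂ (C⇒linked _ Cmid Cnext))))

  segment⊆ : ∀ a d → C a → C (a + d) → ∀ m → m < suc d → (a + m , 0) ∈ S
  segment⊆ a d Ca Cend m m≤d =
    C⇒∈ _ (C-convex a (a + m) (a + d) Ca Cend (m≤m+n a m) (+-monoʳ-≤ a (≤-pred m≤d)))

  -- The bounds say that the walk fits into the length S rounds performed by reach.
  spine-reach : ∀ u n i j → C i → C j → (i , 0) ∈ ball adj S u n →
    Σ ℕ λ d → (j , 0) ∈ ball adj S u (d + n) × suc d ≤ length S ×
              (∀ x → x ∈ S → proj₂ x ≢ 0 → suc (suc d) ≤ length S)
  spine-reach u n i j Ci Cj i∈ with ≤-total i j
  ... | inj₁ i≤j =
    let d = j ∸ i
        i+d≡j = m+[n∸m]≡n i≤j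
        Cend = subst C (sym i+d≡j) Cj
    in d , subst (λ x → (x , 0) ∈ ball adj S u (d + n)) i+d≡j (walk-up u n i d Ci Cend i∈)
         , segment≤length i (suc d) S (segment⊆ i d Ci Cend)
         , (λ x → segment+leaf≤length i (suc d) S x (segment⊆ i d Ci Cend))
  ... | inj₂ j≤i =
    let d = i ∸ j
        j+d≡i = m+[n∸m]≡n j≤i
        Cend = subst C (sym j+d≡i) Ci
    in d , walk-down u n j d Cj Cend (subst (λ x → (x , 0) ∈ ball adj S u n) (sym j+d≡i) i∈)
         , segment≤length j (suc d) S (segment⊆ j d Cj Cend)
         , (λ x → segment+leaf≤length j (suc d) S x (segment⊆ j d Cj Cend))

-- Subtrees of a caterpillar

-- The vertex sets of subtrees of a caterpillar are exactly the cohesive ones.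
record Cohesive (S : List Vtx) : Set where
  field
    lone-leaf : ∀ i t → (i , suc t) ∈ S → (i , 0) ∉ S → ∀ v → v ∈ S → v ≡ (i , suc t)
    spine-interval : ∀ i m j → (i , 0) ∈ S → (j , 0) ∈ S → i < m → m < j → (m , 0) ∈ S
open Cohesive public

Cohesive-convex : ∀ {S} → Cohesive S →
  ∀ a m b → (a , 0) ∈ S → (b , 0) ∈ S → a ≤ m → m ≤ b → (m , 0) ∈ S
Cohesive-convex coh a m b a∈ b∈ a≤m m≤b with m≤n⇒m<n∨m≡n a≤m | m≤n⇒m<n∨m≡n m≤b
... | inj₂ refl | _ = a∈
... | _ | inj₂ refl = b∈
... | inj₁ a<m | inj₁ m<b = spine-interval coh a m b a∈ b∈ a<m m<b

module _ (ys : List ℕ) where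

  catAdj-pos : ∀ u w → catAdj ys u w ≡ true → pos w ≤ suc (pos u)
  catAdj-pos (i , zero) (j , zero) e with ∨-true⁻ {suc i ≡ᵇ j} e
  ... | inj₁ up = ≤-reflexive (sym (≡ᵇ-true⇒≡ _ _ up))
  ... | inj₂ down = subst (λ x → j ≤ suc x) (≡ᵇ-true⇒≡ _ _ down) (m≤n⇒m≤1+n (n≤1+n j))
  catAdj-pos (i , zero) (j , suc t) e = m≤n⇒m≤1+n (≤-reflexive (sym (≡ᵇ-true⇒≡ i j e)))
  catAdj-pos (i , suc s) (j , zero) e = m≤n⇒m≤1+n (≤-reflexive (sym (≡ᵇ-true⇒≡ i j e)))

  catAdj-true⁻ : ∀ u w → catAdj ys u w ≡ true →
    pos u ≡ pos w ⊎ (proj₂ u ≡ 0 × proj₂ w ≡ 0 × (suc (pos u) ≡ pos w ⊎ suc (pos w) ≡ pos u))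
  catAdj-true⁻ (i , zero) (j , zero) e with ∨-true⁻ {suc i ≡ᵇ j} e
  ... | inj₁ up = inj₂ (refl , refl , inj₁ (≡ᵇ-true⇒≡ _ _ up))
  ... | inj₂ down = inj₂ (refl , refl , inj₂ (≡ᵇ-true⇒≡ _ _ down))
  catAdj-true⁻ (i , zero) (j , suc t) e = inj₁ (≡ᵇ-true⇒≡ i j e)
  catAdj-true⁻ (i , suc s) (j , zero) e = inj₁ (≡ᵇ-true⇒≡ i j e)

  catAdj-from-leaf : ∀ i t w → catAdj ys (i , suc t) w ≡ true → w ≡ (i , 0)
  catAdj-from-leaf i t (j , zero) e = cong (_, 0) (sym (≡ᵇ-true⇒≡ i j e))

  catAdj-to-leaf : ∀ u j t → catAdj ys u (j , suc t) ≡ true → u ≡ (j , 0)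
  catAdj-to-leaf (i , zero) j t e = cong (_, 0) (≡ᵇ-true⇒≡ i j e)

  catAdj-up : ∀ m → catAdj ys (m , 0) (suc m , 0) ≡ true
  catAdj-up m rewrite ≡ᵇ-refl m = refl

  catAdj-down : ∀ m → catAdj ys (suc m , 0) (m , 0) ≡ true
  catAdj-down m rewrite ≡ᵇ-refl m = ∨-zeroʳ _

  catAdj-spine-leaf : ∀ i t → catAdj ys (i , 0) (i , suc t) ≡ true
  catAdj-spine-leaf i t = ≡ᵇ-refl i

  catAdj-leaf-spine : ∀ i t → catAdj ys (i , suc t) (i , 0) ≡ true
  catAdj-leaf-spine i t = ≡ᵇ-refl i

  connected⇒Cohesive : ∀ S → connected (catAdj ys) S ≡ true → Cohesive S
  lone-leaf (connected⇒Cohesive S conn) i t leaf∈S spine∉S v v∈S =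
    ball-closed (catAdj ys) S (i , suc t) (_≡ (i , suc t)) refl
      (λ { c w refl w∈S c~w → ⊥-elim (spine∉S (subst (_∈ S) (catAdj-from-leaf i t w c~w) w∈S)) })
      (length S) v (connected⇒ball (catAdj ys) S conn _ v leaf∈S v∈S)
  spine-interval (connected⇒Cohesive S conn) i m j i∈S j∈S i<m m<j with (m , 0) ∈ᵇ S in m∈?
  ... | true = ∈ᵇ⇒∈ _ S m∈?
  ... | false = ⊥-elim (<-asym m<j (ball-closed (catAdj ys) S (i , 0) (λ y → pos y < m) i<m below
                  (length S) (j , 0) (connected⇒ball (catAdj ys) S conn _ _ i∈S j∈S)))
    where
    -- an edge from position < m can only reach m at (m , 0) ∉ S
    below : ∀ c w → pos c < m → w ∈ S → catAdj ys c w ≡ true → pos w < m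
    below c (wi , ws) c<m w∈S c~w with m≤n⇒m<n∨m≡n (≤-trans (catAdj-pos c (wi , ws) c~w) c<m)
    ... | inj₁ lt = lt
    below c (wi , zero) c<m w∈S c~w | inj₂ refl = ⊥-elim (∈ᵇ-false⇒∉ m∈? w∈S)
    below c (wi , suc t) c<m w∈S c~w | inj₂ refl =
      ⊥-elim (<-irrefl (cong pos (catAdj-to-leaf c wi t c~w)) c<m)

  Cohesive⇒connected : ∀ S → Cohesive S → connected (catAdj ys) S ≡ true
  Cohesive⇒connected S coh = ball⇒connected (catAdj ys) S reached
    where
    A : Adj
    A = catAdj ys
    open SpineWalk A S (λ m → (m , 0) ∈ S) (Cohesive-convex coh) (λ m m∈ → m∈)
      (λ m _ _ → catAdj-up m , catAdj-down m)
    same : ∀ u w → w ≡ u → w ∈ S → w ∈ ball A S u (length S)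
    same u w w≡u w∈S = ball-mono A S u 0 (length S) z≤n (here w≡u) w∈S
    reached : ∀ u w → u ∈ S → w ∈ S → w ∈ ball A S u (length S)
    reached (iu , zero) (iw , zero) u∈ w∈ =
      let (d , w∈ball , d<S , _) = spine-reach _ 0 iu iw u∈ w∈ (here refl) in
      ball-mono A S _ (d + 0) (length S) (≤-trans (≤-reflexive (+-identityʳ d)) (<⇒≤ d<S)) w∈ball w∈
    reached (iu , zero) (iw , suc t) u∈ w∈ with (iw , 0) ∈ᵇ S in anchor
    ... | false = same _ _ (sym (lone-leaf coh iw t w∈ (∈ᵇ-false⇒∉ anchor) _ u∈)) w∈
    ... | true =
      let (d , a∈ball , d<S , _) = spine-reach _ 0 iu iw u∈ (∈ᵇ⇒∈ _ S anchor) (here refl) in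
      ball-mono A S _ (suc (d + 0)) (length S) (subst (_≤ length S) (cong suc (sym (+-identityʳ d))) d<S)
        (ball-step A S _ (d + 0) a∈ball w∈ (catAdj-spine-leaf iw t)) w∈
    reached (iu , suc t) w u∈ w∈ with (iu , 0) ∈ᵇ S in anchor
    ... | false = same _ _ (lone-leaf coh iu t u∈ (∈ᵇ-false⇒∉ anchor) w w∈) w∈
    reached (iu , suc t) (iw , zero) u∈ w∈ | true =
      let a∈ball = ball-step A S _ 0 (here refl) (∈ᵇ⇒∈ _ S anchor) (catAdj-leaf-spine iu t)
          (d , w∈ball , d<S , _) = spine-reach _ 1 iu iw (∈ᵇ⇒∈ _ S anchor) w∈ a∈ball in
      ball-mono A S _ (d + 1) (length S) (subst (_≤ length S) (+-comm 1 d) d<S) w∈ball w∈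
    reached (iu , suc t) (iw , suc t′) u∈ w∈ | true with (iw , 0) ∈ᵇ S in anchor′
    ... | false = same _ _ (sym (lone-leaf coh iw t′ w∈ (∈ᵇ-false⇒∉ anchor′) _ u∈)) w∈
    ... | true =
      let a∈ball = ball-step A S _ 0 (here refl) (∈ᵇ⇒∈ _ S anchor) (catAdj-leaf-spine iu t)
          (d , b∈ball , _ , d+1<S) =
            spine-reach _ 1 iu iw (∈ᵇ⇒∈ _ S anchor) (∈ᵇ⇒∈ _ S anchor′) a∈ball in
      ball-mono A S _ (suc (d + 1)) (length S)
        (subst (_≤ length S) (cong suc (+-comm 1 d)) (d+1<S (iu , suc t) u∈ (λ ())))
        (ball-step A S _ (d + 1) b∈ball w∈ (catAdj-spine-leaf iw t′)) w∈

LeavesAt : ℕ → List Vtx → Set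
LeavesAt i l = ∀ v → v ∈ l → Σ ℕ λ t → v ≡ (i , suc t)

Beyond : ℕ → List Vtx → Set
Beyond i s = ∀ v → v ∈ s → i < pos v

spine∈-split : ∀ {i l s m} → LeavesAt i l → (m , 0) ∈ (i , 0) ∷ l ++ s → m ≡ i ⊎ (m , 0) ∈ s
spine∈-split leaves (here e) = inj₁ (cong pos e)
spine∈-split {l = l} leaves (there m∈) with ∈-++⁻ l m∈
... | inj₁ m∈l with proj₂ (leaves _ m∈l)
...   | ()
spine∈-split leaves (there m∈) | inj₂ m∈s = inj₂ m∈s

∈-rest : ∀ (i : ℕ) (l : List Vtx) {s v} → v ∈ s → v ∈ (i , 0) ∷ l ++ s
∈-rest i l = there ∘ ∈-++⁺ʳ l

Cohesive-spine∷⁻ : ∀ i l s → LeavesAt i l → Beyond i s →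
  Cohesive ((i , 0) ∷ l ++ s) → s ≡ [] ⊎ ((suc i , 0) ∈ s × Cohesive s)
Cohesive-spine∷⁻ i l [] _ _ _ = inj₁ refl
Cohesive-spine∷⁻ i l s@((j , t) ∷ _) leaves beyond coh =
  inj₂ (next∈s (anchor t (here refl)) , cohesive-s)
  where
  anchor : ∀ t → (j , t) ∈ s → (j , 0) ∈ s
  anchor zero j∈ = j∈
  anchor (suc t) j∈ with (j , 0) ∈ᵇ ((i , 0) ∷ l ++ s) in j∈?
  ... | true with spine∈-split {s = s} {m = j} leaves (∈ᵇ⇒∈ _ _ j∈?)
  ...   | inj₁ refl = ⊥-elim (<-irrefl refl (beyond _ j∈))
  ...   | inj₂ j∈s = j∈s
  anchor (suc t) j∈ | false
    with lone-leaf coh j t (∈-rest i l j∈) (∈ᵇ-false⇒∉ j∈?) (i , 0) (here refl)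
  ...   | ()
  next∈s : (j , 0) ∈ s → (suc i , 0) ∈ s
  next∈s j∈ with m≤n⇒m<n∨m≡n (beyond _ j∈)
  ... | inj₂ refl = j∈
  ... | inj₁ i+1<j
    with spine∈-split {s = s} leaves (spine-interval coh i (suc i) j (here refl) (∈-rest i l j∈) (n<1+n i) i+1<j)
  ...   | inj₁ i+1≡i = ⊥-elim (<-irrefl (sym i+1≡i) (n<1+n i))
  ...   | inj₂ i+1∈s = i+1∈s
  cohesive-s : Cohesive s
  lone-leaf cohesive-s a t a∈ a∉ v v∈ = lone-leaf coh a t (∈-rest i l a∈) absent v (∈-rest i l v∈)
    where
    absent : (a , 0) ∉ (i , 0) ∷ l ++ s
    absent a∈′ with spine∈-split leaves a∈′
    ... | inj₁ refl = <-irrefl refl (beyond _ a∈)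
    ... | inj₂ a∈s = a∉ a∈s
  spine-interval cohesive-s a m b a∈ b∈ a<m m<b
    with spine∈-split {s = s} leaves (spine-interval coh a m b (∈-rest i l a∈) (∈-rest i l b∈) a<m m<b)
  ... | inj₁ refl = ⊥-elim (<-irrefl refl (<-trans (beyond _ a∈) a<m))
  ... | inj₂ m∈s = m∈s

Cohesive-spine∷⁺ : ∀ i l s → LeavesAt i l → Beyond i s →
  s ≡ [] ⊎ ((suc i , 0) ∈ s × Cohesive s) → Cohesive ((i , 0) ∷ l ++ s)
lone-leaf (Cohesive-spine∷⁺ i l s leaves beyond rest) a t (there a∈) a∉ v v∈ with ∈-++⁻ l a∈ | rest
... | inj₁ a∈l | _ = ⊥-elim (a∉ (here (cong (λ v → pos v , 0) (proj₂ (leaves _ a∈l)))))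
lone-leaf (Cohesive-spine∷⁺ i l s leaves beyond rest) a t (there a∈) a∉ v v∈ | inj₂ () | inj₁ refl
lone-leaf (Cohesive-spine∷⁺ i l s leaves beyond rest) a t (there a∈) a∉ v v∈ | inj₂ a∈s | inj₂ (i+1∈ , coh)
  with lone-leaf coh a t a∈s (a∉ ∘ ∈-rest i l) (suc i , 0) i+1∈
... | ()
spine-interval (Cohesive-spine∷⁺ i l s leaves beyond rest) a m b a∈ b∈ a<m m<b
  with spine∈-split leaves a∈ | spine∈-split leaves b∈ | rest
... | inj₁ refl | inj₁ refl | _ = ⊥-elim (<-asym a<m m<b)
... | inj₂ a∈s | inj₁ refl | _ = ⊥-elim (<-asym (beyond _ a∈s) (<-trans a<m m<b))
... | _ | inj₂ () | inj₁ refl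
... | inj₂ a∈s | inj₂ b∈s | inj₂ (_ , coh) = ∈-rest i l (spine-interval coh a m b a∈s b∈s a<m m<b)
... | inj₁ refl | inj₂ b∈s | inj₂ (i+1∈ , coh) with m≤n⇒m<n∨m≡n a<m
...   | inj₂ refl = ∈-rest i l i+1∈
...   | inj₁ i+1<m = ∈-rest i l (spine-interval coh (suc a) m b i+1∈ b∈s i+1<m m<b)

spine∉ : ∀ {i l s} → LeavesAt i l → Beyond i s → (i , 0) ∉ l ++ s
spine∉ {l = l} leaves beyond i∈ with ∈-++⁻ l i∈
... | inj₁ i∈l with proj₂ (leaves _ i∈l)
...   | ()
spine∉ leaves beyond i∈ | inj₂ i∈s = <-irrefl refl (beyond _ i∈s)

module _ (ys : List ℕ) where

  -- the possible parts beyond v_i of a subtree containing v_i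
  attachable : ℕ → List Vtx → Bool
  attachable i s = null s ∨ (((suc i , 0) ∈ᵇ s) ∧ connected (catAdj ys) s)

  connected-spine∷ : ∀ i l s → LeavesAt i l → Beyond i s →
    connected (catAdj ys) ((i , 0) ∷ l ++ s) ≡ attachable i s
  connected-spine∷ i l [] leaves beyond =
    Cohesive⇒connected ys _ (Cohesive-spine∷⁺ i l [] leaves beyond (inj₁ refl))
  connected-spine∷ i l s@(_ ∷ _) leaves beyond = Bool-ext forth back
    where
    forth : connected (catAdj ys) ((i , 0) ∷ l ++ s) ≡ true → attachable i s ≡ true
    forth conn with Cohesive-spine∷⁻ i l s leaves beyond (connected⇒Cohesive ys _ conn)
    ... | inj₂ (i+1∈ , coh) rewrite ∈⇒∈ᵇ i+1∈ = Cohesive⇒connected ys s coh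
    back : attachable i s ≡ true → connected (catAdj ys) ((i , 0) ∷ l ++ s) ≡ true
    back att = let (i+1∈ , conn) = ∧-true⁻ {(suc i , 0) ∈ᵇ s} att in
      Cohesive⇒connected ys _ (Cohesive-spine∷⁺ i l s leaves beyond
        (inj₂ (∈ᵇ⇒∈ _ _ i+1∈ , connected⇒Cohesive ys _ conn)))

  connected-leaf∷ : ∀ i t S → (i , 0) ∉ S → (i , suc t) ∉ S →
    connected (catAdj ys) ((i , suc t) ∷ S) ≡ null S
  connected-leaf∷ i t [] _ _ = Cohesive⇒connected ys _ single
    where
    single : Cohesive ((i , suc t) ∷ [])
    lone-leaf single a t′ (here refl) _ v (here refl) = refl
    spine-interval single a m b (here ()) _ _ _
  connected-leaf∷ i t (v ∷ S) spine∉S leaf∉S = ¬-not λ conn →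
    leaf∉S (here (sym (lone-leaf (connected⇒Cohesive ys _ conn) i t (here refl)
                    (λ { (there i∈) → spine∉S i∈ }) v (there (here refl)))))

module _ {A : Set} where

  sumMap : (A → ℕ) → List A → ℕ
  sumMap f xs = sum (map f xs)

  sumMap-++ : ∀ f xs ys → sumMap f (xs ++ ys) ≡ sumMap f xs + sumMap f ys
  sumMap-++ f xs ys = trans (cong sum (map-++ f xs ys)) (sum-++ (map f xs) (map f ys))

  sumMap-map : ∀ f (g : A → A) xs → sumMap f (map g xs) ≡ sumMap (f ∘ g) xs
  sumMap-map f g xs = cong sum (sym (map-∘ xs))

  sumMap-const : ∀ f c xs → (∀ x → x ∈ xs → f x ≡ c) → sumMap f xs ≡ length xs * c
  sumMap-const f c [] _ = refl
  sumMap-const f c (x ∷ xs) h = cong₂ _+_ (h x (here refl)) (sumMap-const f c xs (λ y → h y ∘ there))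

module _ {A : Set} where

  length-subs : ∀ (xs : List A) → length (subs xs) ≡ 2 ^ length xs
  length-subs [] = refl
  length-subs (x ∷ xs) = begin
    length (map (x ∷_) (subs xs) ++ subs xs)
      ≡⟨ length-++ (map (x ∷_) (subs xs)) ⟩
    length (map (x ∷_) (subs xs)) + length (subs xs)
      ≡⟨ cong (_+ length (subs xs)) (length-map (x ∷_) (subs xs)) ⟩
    length (subs xs) + length (subs xs)
      ≡⟨ cong (λ a → a + a) (length-subs xs) ⟩
    2 ^ length xs + 2 ^ length xs
      ≡⟨ cong (2 ^ length xs +_) (sym (+-identityʳ _)) ⟩
    2 ^ length (x ∷ xs) ∎
    where open ≡-Reasoning

  subs-⊆ : ∀ (X : List A) {l v} → l ∈ subs X → v ∈ l → v ∈ X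
  subs-⊆ [] (here refl) ()
  subs-⊆ (x ∷ X) l∈ v∈l with ∈-++⁻ (map (x ∷_) (subs X)) l∈
  ... | inj₂ l∈′ = there (subs-⊆ X l∈′ v∈l)
  ... | inj₁ l∈′ with ∈-map⁻ (x ∷_) l∈′
  ...   | l′ , l′∈ , refl with v∈l
  ...     | here v≡x = here v≡x
  ...     | there v∈l′ = there (subs-⊆ X l′∈ v∈l′)

  subs-∷⁺ʳ : ∀ x (X : List A) {l} → l ∈ subs X → l ∈ subs (x ∷ X)
  subs-∷⁺ʳ x X = ∈-++⁺ʳ (map (x ∷_) (subs X))

  countB-subs-∷ : ∀ (P : List A → Bool) x X →
    countB P (subs (x ∷ X)) ≡ countB (P ∘ (x ∷_)) (subs X) + countB P (subs X)
  countB-subs-∷ P x X = trans (countB-++ P (map (x ∷_) (subs X)) (subs X))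
                              (cong (_+ countB P (subs X)) (countB-map P (x ∷_) (subs X)))

  countB-subs-++ : ∀ (P : List A → Bool) X Y →
    countB P (subs (X ++ Y)) ≡ sumMap (λ l → countB (λ s → P (l ++ s)) (subs Y)) (subs X)
  countB-subs-++ P [] Y = sym (+-identityʳ _)
  countB-subs-++ P (x ∷ X) Y
    rewrite countB-subs-∷ P x (X ++ Y) | countB-subs-++ (P ∘ (x ∷_)) X Y | countB-subs-++ P X Y
          | sumMap-++ (λ l → countB (λ s → P (l ++ s)) (subs Y)) (map (x ∷_) (subs X)) (subs X)
          | sumMap-map (λ l → countB (λ s → P (l ++ s)) (subs Y)) (x ∷_) (subs X) = refl

  countB-null-subs : ∀ c (X : List A) → countB (λ S → c ∧ null S) (subs X) ≡ (if c then 1 else 0)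
  countB-null-subs c [] with c
  ... | true = refl
  ... | false = refl
  countB-null-subs c (x ∷ X)
    rewrite countB-subs-∷ (λ S → c ∧ null S) x X
          | countB-none (λ S → c ∧ null (x ∷ S)) (subs X) (λ _ _ → ∧-zeroʳ c) = countB-null-subs c X

  countB-subs-free : ∀ (P Q : List A → Bool) X Y →
    (∀ l s → l ∈ subs X → s ∈ subs Y → P (l ++ s) ≡ Q s) →
    countB P (subs (X ++ Y)) ≡ 2 ^ length X * countB Q (subs Y)
  countB-subs-free P Q X Y free rewrite countB-subs-++ P X Y | sym (length-subs X) =
    sumMap-const _ _ (subs X) (λ l l∈ → countB-cong _ Q (subs Y) (λ s s∈ → free l s l∈ s∈))

  head∉subs : ∀ {x} X Y → All (x ≢_) X → x ∉ Y → ∀ {S} → S ∈ subs (X ++ Y) → x ∉ S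
  head∉subs X Y x∉X x∉Y S∈ x∈S with ∈-++⁻ X (subs-⊆ (X ++ Y) S∈ x∈S)
  ... | inj₁ x∈X = All¬⇒¬Any x∉X x∈X
  ... | inj₂ x∈Y = x∉Y x∈Y

  countB-subs-isolated : ∀ (P : List A → Bool) c X Y → Unique X → (∀ x → x ∈ X → x ∉ Y) →
    (∀ x S → x ∈ X → S ∈ subs (X ++ Y) → x ∉ S → P (x ∷ S) ≡ c ∧ null S) →
    countB P (subs (X ++ Y)) ≡ (if c then length X else 0) + countB P (subs Y)
  countB-subs-isolated P c [] Y _ _ _ with c
  ... | true = refl
  ... | false = refl
  countB-subs-isolated P c (x ∷ X) Y (x∉X ∷ unique) disjoint isolated
    rewrite countB-subs-∷ P x (X ++ Y)
          | countB-cong (P ∘ (x ∷_)) (λ S → c ∧ null S) (subs (X ++ Y))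
              (λ S S∈ → isolated x S (here refl) (subs-∷⁺ʳ x (X ++ Y) S∈)
                        (head∉subs X Y x∉X (disjoint x (here refl)) S∈))
          | countB-null-subs c (X ++ Y)
          | countB-subs-isolated P c X Y unique (λ y → disjoint y ∘ there)
              (λ y S y∈ S∈ → isolated y S (there y∈) (subs-∷⁺ʳ x (X ++ Y) S∈))
    with c
  ... | true = refl
  ... | false = refl

-- Counting subtrees block by block

leaves : ℕ → ℕ → List Vtx
leaves i z = map (λ t → (i , suc t)) (upTo z)

block : ℕ → ℕ → List Vtx
block i z = (i , 0) ∷ leaves i z

-- the caterpillar piece with spine v_i, v_{i+1}, … carrying z₀, z₁, … pendant vertices;
-- fFirst, fLast, fSpan and φSpine below count its subtrees through v_i, through its last
-- spine vertex, through both, and all of them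
blocks : ℕ → List ℕ → List Vtx
blocks i [] = []
blocks i (z ∷ zs) = block i z ++ blocks (suc i) zs

fFirst : List ℕ → ℕ
fFirst [] = 0
fFirst (z ∷ zs) = 2 ^ z * suc (fFirst zs)

fSpan : List ℕ → ℕ
fSpan [] = 1
fSpan (z ∷ zs) = 2 ^ z * fSpan zs

fLast : List ℕ → ℕ
fLast [] = 0
fLast (z ∷ zs) = 2 ^ z * fSpan zs + fLast zs

φSpine : List ℕ → ℕ
φSpine [] = 0
φSpine (z ∷ zs) = fFirst (z ∷ zs) + (z + φSpine zs)

length-leaves : ∀ i z → length (leaves i z) ≡ z
length-leaves i z = trans (length-map _ (upTo z)) (length-upTo z)

leaves-unique : ∀ i z → Unique (leaves i z)
leaves-unique i z = map⁺ (λ e → suc-injective (cong proj₂ e)) (upTo⁺ z)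

leaves-at : ∀ i z → LeavesAt i (leaves i z)
leaves-at i z v v∈ with ∈-map⁻ (λ t → (i , suc t)) v∈
... | t , _ , v≡ = t , v≡

subs-leaves : ∀ i z {l} → l ∈ subs (leaves i z) → LeavesAt i l
subs-leaves i z l∈ v = leaves-at i z v ∘ subs-⊆ (leaves i z) l∈

block-pos : ∀ j z v → v ∈ block j z → pos v ≡ j
block-pos j z v (here refl) = refl
block-pos j z v (there v∈l) with leaves-at j z v v∈l
... | _ , refl = refl

blocks-pos< : ∀ j zs v → v ∈ blocks j zs → pos v < j + length zs
blocks-pos< j (z ∷ zs) v v∈ with ∈-++⁻ (block j z) v∈
... | inj₁ v∈b = subst (_< j + suc (length zs)) (sym (block-pos j z v v∈b)) (m<m+n j (s≤s z≤n))
... | inj₂ v∈′ = subst (pos v <_) (sym (+-suc j (length zs))) (blocks-pos< (suc j) zs v v∈′)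

blocks-spine : ∀ j zs m → m < length zs → (j + m , 0) ∈ blocks j zs
blocks-spine j (z ∷ zs) zero _ rewrite +-identityʳ j = here refl
blocks-spine j (z ∷ zs) (suc m) (s≤s m<) rewrite +-suc j m =
  ∈-++⁺ʳ (block j z) (blocks-spine (suc j) zs m m<)

blocks-pos : ∀ j zs v → v ∈ blocks j zs → j ≤ pos v
blocks-pos j (z ∷ zs) v v∈ with ∈-++⁻ (block j z) v∈
... | inj₁ v∈b = ≤-reflexive (sym (block-pos j z v v∈b))
... | inj₂ v∈′ = <⇒≤ (blocks-pos (suc j) zs v v∈′)

blocks-++ : ∀ i X Y → blocks i (X ++ Y) ≡ blocks i X ++ blocks (i + length X) Y
blocks-++ i [] Y rewrite +-identityʳ i = refl
blocks-++ i (x ∷ X) Y rewrite blocks-++ (suc i) X Y | +-suc i (length X) =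
  sym (++-assoc (block i x) (blocks (suc i) X) _)

subs-blocks : ∀ i zs {s} → s ∈ subs (blocks (suc i) zs) → Beyond i s
subs-blocks i zs s∈ v v∈s = blocks-pos (suc i) zs v (subs-⊆ (blocks (suc i) zs) s∈ v∈s)

spine∉subs : ∀ i z zs {S} → S ∈ subs (leaves i z ++ blocks (suc i) zs) → (i , 0) ∉ S
spine∉subs i z zs S∈ =
  spine∉ (leaves-at i z) (blocks-pos (suc i) zs) ∘ subs-⊆ (leaves i z ++ blocks (suc i) zs) S∈

leaves∉blocks : ∀ i z zs x → x ∈ leaves i z → x ∉ blocks (suc i) zs
leaves∉blocks i z zs x x∈ x∈B with leaves-at i z x x∈
... | _ , refl = <-irrefl refl (blocks-pos (suc i) zs x x∈B)

∈ᵇ-spine∷ : ∀ e i l s → e ≢ i → LeavesAt i l → (e , 0) ∈ᵇ ((i , 0) ∷ l ++ s) ≡ (e , 0) ∈ᵇ s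
∈ᵇ-spine∷ e i l s e≢i leaves =
  Bool-ext forth (λ e∈ → ∈⇒∈ᵇ {e , 0} (∈-rest i l (∈ᵇ⇒∈ _ s e∈)))
  where
  forth : (e , 0) ∈ᵇ ((i , 0) ∷ l ++ s) ≡ true → (e , 0) ∈ᵇ s ≡ true
  forth e∈ with spine∈-split leaves (∈ᵇ⇒∈ _ _ e∈)
  ... | inj₁ e≡i = ⊥-elim (e≢i e≡i)
  ... | inj₂ e∈s = ∈⇒∈ᵇ {e , 0} e∈s

countB-subs-block : ∀ (P Q : List Vtx → Bool) i z B →
  (∀ l s → l ∈ subs (leaves i z) → s ∈ subs B → P ((i , 0) ∷ l ++ s) ≡ Q s) →
  countB P (subs (block i z ++ B)) ≡ 2 ^ z * countB Q (subs B) + countB P (subs (leaves i z ++ B))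
countB-subs-block P Q i z B free
  rewrite countB-subs-∷ P (i , 0) (leaves i z ++ B)
        | countB-subs-free (P ∘ ((i , 0) ∷_)) Q (leaves i z) B free | length-leaves i z = refl

module _ (ys : List ℕ) where

  private
    conn : List Vtx → Bool
    conn = connected (catAdj ys)

  subtree : List Vtx → Bool
  subtree S = nonempty S ∧ conn S

  subtreeAt : ℕ → List Vtx → Bool
  subtreeAt i S = ((i , 0) ∈ᵇ S) ∧ conn S

  subtreeAt₂ : ℕ → ℕ → List Vtx → Bool
  subtreeAt₂ i j S = (((i , 0) ∈ᵇ S) ∧ ((j , 0) ∈ᵇ S)) ∧ conn S

  countB-attachable : ∀ i zs → let B = blocks (suc i) zs in
    countB (attachable ys i) (subs B) ≡ suc (countB (subtreeAt (suc i)) (subs B))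
  countB-attachable i zs =
    trans (countB-∨ null (subtreeAt (suc i)) (subs (blocks (suc i) zs))
             (λ { [] _ → refl ; (_ ∷ _) _ → refl }))
          (cong (_+ countB (subtreeAt (suc i)) (subs (blocks (suc i) zs)))
                (countB-null-subs true (blocks (suc i) zs)))

  ∈ᵇ∧attachable : ∀ e i s → ((e , 0) ∈ᵇ s) ∧ attachable ys i s ≡ subtreeAt₂ (suc i) e s
  ∈ᵇ∧attachable e i [] = refl
  ∈ᵇ∧attachable e i s@(_ ∷ _) =
    trans (sym (∧-assoc ((e , 0) ∈ᵇ s) ((suc i , 0) ∈ᵇ s) (conn s)))
          (cong (_∧ conn s) (∧-comm ((e , 0) ∈ᵇ s) ((suc i , 0) ∈ᵇ s)))

  subtreeAt-spine∷ : ∀ e i l s → e ≢ i → LeavesAt i l → Beyond i s →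
    subtreeAt e ((i , 0) ∷ l ++ s) ≡ subtreeAt₂ (suc i) e s
  subtreeAt-spine∷ e i l s e≢i leaves beyond =
    trans (cong₂ _∧_ (∈ᵇ-spine∷ e i l s e≢i leaves) (connected-spine∷ ys i l s leaves beyond))
          (∈ᵇ∧attachable e i s)

  subtreeAt₂-spine∷ : ∀ e i l s → e ≢ i → LeavesAt i l → Beyond i s →
    subtreeAt₂ i e ((i , 0) ∷ l ++ s) ≡ subtreeAt₂ (suc i) e s
  subtreeAt₂-spine∷ e i l s e≢i leaves beyond =
    trans (cong (λ a → (a ∧ ((e , 0) ∈ᵇ S)) ∧ conn S) (∈ᵇ-head (i , 0) (l ++ s)))
          (subtreeAt-spine∷ e i l s e≢i leaves beyond)
    where S = (i , 0) ∷ l ++ s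

  fFirst-count : ∀ i zs → countB (subtreeAt i) (subs (blocks i zs)) ≡ fFirst zs
  fFirst-count i [] = refl
  fFirst-count i (z ∷ zs) = begin
    countB (subtreeAt i) (subs (block i z ++ B))
      ≡⟨ countB-subs-block (subtreeAt i) (attachable ys i) i z B (λ l s l∈ s∈ →
           cong₂ _∧_ (∈ᵇ-head (i , 0) (l ++ s))
                     (connected-spine∷ ys i l s (subs-leaves i z l∈) (subs-blocks i zs s∈))) ⟩
    2 ^ z * countB (attachable ys i) (subs B) + countB (subtreeAt i) (subs (leaves i z ++ B))
      ≡⟨ cong₂ (λ a b → 2 ^ z * a + b)
           (trans (countB-attachable i zs) (cong suc (fFirst-count (suc i) zs)))
           (countB-none _ _ (λ S S∈ → cong (_∧ conn S) (∉⇒∈ᵇ-false (spine∉subs i z zs S∈)))) ⟩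
    2 ^ z * suc (fFirst zs) + 0
      ≡⟨ +-identityʳ _ ⟩
    fFirst (z ∷ zs) ∎
    where
    open ≡-Reasoning
    B : List Vtx
    B = blocks (suc i) zs

  φSpine-count : ∀ i zs → countB subtree (subs (blocks i zs)) ≡ φSpine zs
  φSpine-count i [] = refl
  φSpine-count i (z ∷ zs) = begin
    countB subtree (subs (block i z ++ B))
      ≡⟨ countB-subs-block subtree (attachable ys i) i z B (λ l s l∈ s∈ →
           connected-spine∷ ys i l s (subs-leaves i z l∈) (subs-blocks i zs s∈)) ⟩
    2 ^ z * countB (attachable ys i) (subs B) + countB subtree (subs (leaves i z ++ B))
      ≡⟨ cong₂ _+_ (cong (2 ^ z *_) (trans (countB-attachable i zs) (cong suc (fFirst-count (suc i) zs))))
                   (countB-subs-isolated subtree true (leaves i z) B (leaves-unique i z)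
                      (leaves∉blocks i z zs) isolated) ⟩
    fFirst (z ∷ zs) + (length (leaves i z) + countB subtree (subs B))
      ≡⟨ cong₂ (λ a b → fFirst (z ∷ zs) + (a + b)) (length-leaves i z) (φSpine-count (suc i) zs) ⟩
    φSpine (z ∷ zs) ∎
    where
    open ≡-Reasoning
    B : List Vtx
    B = blocks (suc i) zs
    isolated : ∀ x S → x ∈ leaves i z → S ∈ subs (leaves i z ++ B) → x ∉ S →
               subtree (x ∷ S) ≡ null S
    isolated x S x∈ S∈ x∉S with leaves-at i z x x∈
    ... | t , refl = connected-leaf∷ ys i t S (spine∉subs i z zs S∈) x∉S

  fSpan-count : ∀ i z zs →
    countB (subtreeAt₂ i (i + length zs)) (subs (blocks i (z ∷ zs))) ≡ fSpan (z ∷ zs)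
  fSpan-count i z [] rewrite +-identityʳ i = begin
    countB P (subs (block i z ++ []))
      ≡⟨ countB-subs-block P (λ _ → true) i z [] (λ { l .[] l∈ (here refl) →
           cong₂ (λ a b → (a ∧ a) ∧ b) (∈ᵇ-head (i , 0) (l ++ []))
                 (connected-spine∷ ys i l [] (subs-leaves i z l∈) (λ _ ()))}) ⟩
    2 ^ z * 1 + countB P (subs (leaves i z ++ []))
      ≡⟨ cong (2 ^ z * 1 +_) (countB-none _ _ (λ S S∈ →
           cong (λ a → (a ∧ a) ∧ conn S) (∉⇒∈ᵇ-false (spine∉subs i z [] S∈)))) ⟩
    2 ^ z * 1 + 0
      ≡⟨ +-identityʳ _ ⟩
    fSpan (z ∷ []) ∎
    where
    open ≡-Reasoning
    P : List Vtx → Bool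
    P = subtreeAt₂ i i
  fSpan-count i z (z′ ∷ zs) rewrite +-suc i (length zs) = begin
    countB P (subs (block i z ++ B))
      ≡⟨ countB-subs-block P (subtreeAt₂ (suc i) e) i z B (λ l s l∈ s∈ →
           subtreeAt₂-spine∷ e i l s e≢i (subs-leaves i z l∈) (subs-blocks i (z′ ∷ zs) s∈)) ⟩
    2 ^ z * countB (subtreeAt₂ (suc i) e) (subs B) + countB P (subs (leaves i z ++ B))
      ≡⟨ cong₂ _+_ (cong (2 ^ z *_) (fSpan-count (suc i) z′ zs))
           (countB-none _ _ (λ S S∈ →
              cong (λ a → (a ∧ ((e , 0) ∈ᵇ S)) ∧ conn S) (∉⇒∈ᵇ-false (spine∉subs i z (z′ ∷ zs) S∈)))) ⟩
    fSpan (z ∷ z′ ∷ zs) + 0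
      ≡⟨ +-identityʳ _ ⟩
    fSpan (z ∷ z′ ∷ zs) ∎
    where
    open ≡-Reasoning
    e : ℕ
    e = suc (i + length zs)
    e≢i : e ≢ i
    e≢i = >⇒≢ (s≤s (m≤m+n i (length zs)))
    P : List Vtx → Bool
    P = subtreeAt₂ i e
    B : List Vtx
    B = blocks (suc i) (z′ ∷ zs)

  fLast-count : ∀ i z zs → countB (subtreeAt (i + length zs)) (subs (blocks i (z ∷ zs))) ≡ fLast (z ∷ zs)
  fLast-count i z [] rewrite +-identityʳ i = trans (fFirst-count i (z ∷ [])) (sym (+-identityʳ _))
  fLast-count i z (z′ ∷ zs) rewrite +-suc i (length zs) = begin
    countB P (subs (block i z ++ B))
      ≡⟨ countB-subs-block P (subtreeAt₂ (suc i) e) i z B (λ l s l∈ s∈ →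
           subtreeAt-spine∷ e i l s e≢i (subs-leaves i z l∈) (subs-blocks i (z′ ∷ zs) s∈)) ⟩
    2 ^ z * countB (subtreeAt₂ (suc i) e) (subs B) + countB P (subs (leaves i z ++ B))
      ≡⟨ cong₂ _+_ (cong (2 ^ z *_) (fSpan-count (suc i) z′ zs))
           (countB-subs-isolated P false (leaves i z) B (leaves-unique i z)
              (leaves∉blocks i z (z′ ∷ zs)) isolated) ⟩
    2 ^ z * fSpan (z′ ∷ zs) + countB P (subs B)
      ≡⟨ cong (2 ^ z * fSpan (z′ ∷ zs) +_) (fLast-count (suc i) z′ zs) ⟩
    fLast (z ∷ z′ ∷ zs) ∎
    where
    open ≡-Reasoning
    e : ℕ
    e = suc (i + length zs)
    e≢i : e ≢ i
    e≢i = >⇒≢ (s≤s (m≤m+n i (length zs)))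
    P : List Vtx → Bool
    P = subtreeAt e
    B : List Vtx
    B = blocks (suc i) (z′ ∷ zs)
    isolated : ∀ x S → x ∈ leaves i z → S ∈ subs (leaves i z ++ B) → x ∉ S → P (x ∷ S) ≡ false
    isolated x S x∈ S∈ x∉S with leaves-at i z x x∈
    ... | t , refl rewrite connected-leaf∷ ys i t S (spine∉subs i z (z′ ∷ zs) S∈) x∉S with S
    ...   | [] rewrite ∧-zeroʳ (e ≡ᵇ i) = refl
    ...   | _ ∷ _ = ∧-zeroʳ _

joins : Vtx → Vtx → Vtx × Vtx → Bool
joins u w (a , b) = (eqV u a ∧ eqV w b) ∨ (eqV u b ∧ eqV w a)

joins-true⁻ : ∀ u w e → joins u w e ≡ true → e ≡ (u , w) ⊎ e ≡ (w , u)
joins-true⁻ u w (a , b) e with ∨-true⁻ {eqV u a ∧ eqV w b} e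
... | inj₁ e′ = let (u≡a , w≡b) = ∧-true⁻ {eqV u a} e′ in
                inj₁ (sym (cong₂ _,_ (eqV-true⇒≡ u a u≡a) (eqV-true⇒≡ w b w≡b)))
... | inj₂ e′ = let (u≡b , w≡a) = ∧-true⁻ {eqV u b} e′ in
                inj₂ (sym (cong₂ _,_ (eqV-true⇒≡ w a w≡a) (eqV-true⇒≡ u b u≡b)))

joins-true⁺ : ∀ u w e → e ≡ (u , w) ⊎ e ≡ (w , u) → joins u w e ≡ true
joins-true⁺ u w _ (inj₁ refl) rewrite eqV-refl u | eqV-refl w = refl
joins-true⁺ u w _ (inj₂ refl) rewrite eqV-refl u | eqV-refl w = ∨-zeroʳ _

-- joins u w is the edge test inside deleteEdges, so that
-- deleteEdges adj es u w reduces to adj u w ∧ not (any (joins u w) es)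

deleteEdges-kept : ∀ adj es u w → (u , w) ∉ es → (w , u) ∉ es → deleteEdges adj es u w ≡ adj u w
deleteEdges-kept adj es u w uw∉ wu∉ =
  trans (cong (λ b → adj u w ∧ not b) (¬-not unmatched)) (∧-identityʳ (adj u w))
  where
  unmatched : any (joins u w) es ≢ true
  unmatched m with any-true⁻ (joins u w) es m
  ... | e , e∈ , j = [ (λ e≡ → uw∉ (subst (_∈ es) e≡ e∈)) , (λ e≡ → wu∉ (subst (_∈ es) e≡ e∈)) ]′
                       (joins-true⁻ u w e j)

deleteEdges-removed : ∀ adj es u w → (u , w) ∈ es ⊎ (w , u) ∈ es → deleteEdges adj es u w ≡ false
deleteEdges-removed adj es u w e∈ =
  trans (cong (λ b → adj u w ∧ not b) (matched e∈)) (∧-zeroʳ (adj u w))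
  where
  matched : (u , w) ∈ es ⊎ (w , u) ∈ es → any (joins u w) es ≡ true
  matched (inj₁ uw∈) = any-true⁺ (joins u w) uw∈ (joins-true⁺ u w _ (inj₁ refl))
  matched (inj₂ wu∈) = any-true⁺ (joins u w) wu∈ (joins-true⁺ u w _ (inj₂ refl))

filterB-blocks : ∀ (C : ℕ → Bool) X Y W →
  (∀ m → m < length X → C m ≡ false) →
  (∀ m → length X ≤ m → m < length X + length Y → C m ≡ true) →
  (∀ m → length X + length Y ≤ m → m < length X + length Y + length W → C m ≡ false) →
  filterB (C ∘ pos) (blocks 0 (X ++ Y ++ W)) ≡ blocks (length X) Y
filterB-blocks C X Y W before inside after
  rewrite blocks-++ 0 X (Y ++ W) | blocks-++ (length X) Y W
        | filterB-++ (C ∘ pos) (blocks 0 X) (blocks (length X) Y ++ blocks (length X + length Y) W)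
        | filterB-++ (C ∘ pos) (blocks (length X) Y) (blocks (length X + length Y) W)
        | filterB-none (C ∘ pos) (blocks 0 X) (λ v v∈ → before (pos v) (blocks-pos< 0 X v v∈))
        | filterB-all (C ∘ pos) (blocks (length X) Y)
            (λ v v∈ → inside (pos v) (blocks-pos (length X) Y v v∈) (blocks-pos< (length X) Y v v∈))
        | filterB-none (C ∘ pos) (blocks (length X + length Y) W)
            (λ v v∈ → after (pos v) (blocks-pos _ W v v∈) (blocks-pos< _ W v v∈))
  = ++-identityʳ _

-- Deleting edges es from C(ys) so that exactly the spine edges leaving the convex
-- set C of spine positions disappear isolates the blocks over C.
module Component (ys : List ℕ) (es : List (Vtx × Vtx)) (C : ℕ → Bool)
  (C-convex : ∀ a m b → C a ≡ true → C b ≡ true → a ≤ m → m ≤ b → C m ≡ true)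
  (es-leave : ∀ a b → (a , b) ∈ es → C (pos a) ≡ false ⊎ C (pos b) ≡ false)
  (es-cut : ∀ a b → C a ≡ true → C b ≡ false → suc a ≡ b ⊎ suc b ≡ a →
            ((a , 0) , (b , 0)) ∈ es ⊎ ((b , 0) , (a , 0)) ∈ es)
  (z : ℕ) (zs : List ℕ)
  where

  V : List Vtx
  V = blocks 0 (z ∷ zs)

  A′ : Adj
  A′ = deleteEdges (catAdj ys) es

  inside : Vtx → Bool
  inside = C ∘ pos

  A′-inside : ∀ u w → inside u ≡ true → inside w ≡ true → A′ u w ≡ catAdj ys u w
  A′-inside u w u∈C w∈C = deleteEdges-kept (catAdj ys) es u w (kept u w u∈C w∈C) (kept w u w∈C u∈C)
    where
    kept : ∀ a b → inside a ≡ true → inside b ≡ true → (a , b) ∉ es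
    kept a b a∈C b∈C ab∈ with es-leave a b ab∈
    ... | inj₁ a∉C with trans (sym a∉C) a∈C
    ...   | ()
    kept a b a∈C b∈C ab∈ | inj₂ b∉C with trans (sym b∉C) b∈C
    ...   | ()

  A′-cut : ∀ u w → inside u ≡ true → inside w ≡ false → A′ u w ≡ false
  A′-cut u@(a , i) w@(b , j) u∈C w∉C =
    ¬-not λ u~w → absurd u~w (catAdj-true⁻ ys u w (proj₁ (∧-true⁻ {catAdj ys u w} u~w)))
    where
    absurd : A′ u w ≡ true → a ≡ b ⊎ (i ≡ 0 × j ≡ 0 × (suc a ≡ b ⊎ suc b ≡ a)) → ⊥
    absurd _ (inj₁ same) with trans (sym w∉C) (trans (cong C (sym same)) u∈C)
    ... | ()
    absurd u~w (inj₂ (i≡0 , j≡0 , adjacent))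
      with trans (sym u~w)
             (subst₂ (λ x y → A′ (a , x) (b , y) ≡ false) (sym i≡0) (sym j≡0)
               (deleteEdges-removed (catAdj ys) es (a , 0) (b , 0) (es-cut a b u∈C w∉C adjacent)))
    ... | ()

  private
    C-spine : ℕ → Set
    C-spine m = C m ≡ true × m < length (z ∷ zs)

  open SpineWalk A′ V C-spine
    (λ a m b (a∈C , _) (b∈C , b<) a≤m m≤b → C-convex a m b a∈C b∈C a≤m m≤b , ≤-<-trans m≤b b<)
    (λ m (_ , m<) → blocks-spine 0 (z ∷ zs) m m<)
    (λ m (m∈C , _) (m+1∈C , _) → trans (A′-inside (m , 0) (suc m , 0) m∈C m+1∈C) (catAdj-up ys m) ,
                                 trans (A′-inside (suc m , 0) (m , 0) m+1∈C m∈C) (catAdj-down ys m))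

  module _ (j : ℕ) (j∈C : C j ≡ true) (j< : j < length (z ∷ zs)) where

    inside⇒reached : ∀ w → w ∈ V → inside w ≡ true → w ∈ ball A′ V (j , 0) (length V)
    inside⇒reached (m , t) w∈ w∈C
      with spine-reach (j , 0) 0 j m (j∈C , j<) (w∈C , blocks-pos< 0 (z ∷ zs) _ w∈) (here refl)
    inside⇒reached (m , zero) w∈ w∈C | d , w∈ball , d<V , _ =
      ball-mono A′ V _ (d + 0) (length V) (≤-trans (≤-reflexive (+-identityʳ d)) (<⇒≤ d<V)) w∈ball w∈
    inside⇒reached (m , suc t) w∈ w∈C | d , m∈ball , d<V , _ =
      ball-mono A′ V _ (suc (d + 0)) (length V) (subst (_≤ length V) (cong suc (sym (+-identityʳ d))) d<V)
        (ball-step A′ V _ (d + 0) m∈ball w∈ leaf-edge) w∈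
      where
      leaf-edge : A′ (m , 0) (m , suc t) ≡ true
      leaf-edge = trans (A′-inside (m , 0) (m , suc t) w∈C w∈C) (catAdj-spine-leaf ys m t)

    component≡filterB : component V A′ (j , 0) ≡ filterB inside V
    -- reach performs length V = suc (length (leaves 0 z ++ blocks 1 zs)) rounds
    component≡filterB = ball≡filterB A′ V (j , 0) (length (leaves 0 z ++ blocks 1 zs)) inside
      (λ w _ → ball-closed A′ V (j , 0) (λ y → inside y ≡ true) j∈C
                 (λ c y c∈C _ c~y → ¬-not (λ y∉C → false≢true (trans (sym (A′-cut c y c∈C y∉C)) c~y)))
                 (length V) w)
      inside⇒reached

    fComp≡countB : catVerts ys ≡ V → fComp ys es j ≡ countB (subtreeAt ys j) (subs (filterB inside V))
    fComp≡countB verts = begin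
      countB P′ (subs (component (catVerts ys) A′ (j , 0)))
        ≡⟨ cong (λ W → countB P′ (subs (component W A′ (j , 0)))) verts ⟩
      countB P′ (subs (component V A′ (j , 0)))
        ≡⟨ cong (countB P′ ∘ subs) component≡filterB ⟩
      countB P′ (subs (filterB inside V))
        ≡⟨ countB-cong _ _ (subs (filterB inside V)) (λ S S∈ →
             cong (((j , 0) ∈ᵇ S) ∧_) (connected-cong A′ (catAdj ys) S (λ a b a∈ b∈ →
               A′-inside a b (in-C S∈ a∈) (in-C S∈ b∈)))) ⟩
      countB (subtreeAt ys j) (subs (filterB inside V)) ∎
      where
      open ≡-Reasoning
      P′ : List Vtx → Bool
      P′ S = ((j , 0) ∈ᵇ S) ∧ connected A′ S
      in-C : ∀ {S v} → S ∈ subs (filterB inside V) → v ∈ S → inside v ≡ true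
      in-C S∈ v∈ = proj₂ (filterB-∈⁻ inside V (subs-⊆ (filterB inside V) S∈ v∈))

    fComp≡countB-blocks : catVerts ys ≡ V → ∀ X Y W → z ∷ zs ≡ X ++ Y ++ W →
      (∀ m → m < length X → C m ≡ false) →
      (∀ m → length X ≤ m → m < length X + length Y → C m ≡ true) →
      (∀ m → length X + length Y ≤ m → m < length X + length Y + length W → C m ≡ false) →
      fComp ys es j ≡ countB (subtreeAt ys j) (subs (blocks (length X) Y))
    fComp≡countB-blocks verts X Y W Z≡ before within after =
      trans (fComp≡countB verts) (cong (countB (subtreeAt ys j) ∘ subs)
        (trans (cong (filterB inside ∘ blocks 0) Z≡) (filterB-blocks C X Y W before within after)))

window : (ℕ → ℕ) → ℕ → ℕ → List ℕ
window g s zero = []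
window g s (suc n) = g s ∷ window g (suc s) n

length-window : ∀ g s n → length (window g s n) ≡ n
length-window g s zero = refl
length-window g s (suc n) = cong suc (length-window g (suc s) n)

window-++ : ∀ g s m n → window g s (m + n) ≡ window g s m ++ window g (s + m) n
window-++ g s zero n rewrite +-identityʳ s = refl
window-++ g s (suc m) n rewrite +-suc s m = cong (g s ∷_) (window-++ g (suc s) m n)

window-∷ʳ : ∀ g s n → window g s (suc n) ≡ window g s n ++ g (s + n) ∷ []
window-∷ʳ g s n = trans (cong (window g s) (+-comm 1 n)) (window-++ g s n 1)

-- C(y₁,…,y_k) has the pendant counts 0, y₁, …, y_k, 0 along its spine v₀ … v_{k+1}
pendants : List ℕ → List ℕ
pendants ys = 0 ∷ ys ++ 0 ∷ []

window-yAt-shift : ∀ y ys s n → window (yAt (y ∷ ys)) (suc (suc s)) n ≡ window (yAt ys) (suc s) n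
window-yAt-shift y ys s zero = refl
window-yAt-shift y ys s (suc n) = cong (yAt ys (suc s) ∷_) (window-yAt-shift y ys (suc s) n)

window-yAt : ∀ ys → window (yAt ys) 1 (length ys) ≡ ys
window-yAt [] = refl
window-yAt (y ∷ ys) = cong (y ∷_) (trans (window-yAt-shift y ys 0 (length ys)) (window-yAt ys))

yAt-beyond : ∀ ys → yAt ys (suc (length ys)) ≡ 0
yAt-beyond [] = refl
yAt-beyond (y ∷ []) = refl
yAt-beyond (y ∷ y′ ∷ ys) = yAt-beyond (y′ ∷ ys)

window-yAt-pendants : ∀ ys → window (yAt ys) 0 (2 + length ys) ≡ pendants ys
window-yAt-pendants ys = cong (0 ∷_) (trans (window-∷ʳ (yAt ys) 1 (length ys))
  (cong₂ (λ xs y → xs ++ y ∷ []) (window-yAt ys) (yAt-beyond ys)))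

catVerts≡blocks : ∀ ys → catVerts ys ≡ blocks 0 (pendants ys)
catVerts≡blocks ys = trans (concat-blocks (yAt ys) id 0 (2 + length ys) (λ _ → refl))
                           (cong (blocks 0) (window-yAt-pendants ys))
  where
  concat-blocks : ∀ g h i n → (∀ m → h m ≡ i + m) →
    concatMap (λ j → block j (g j)) (applyUpTo h n) ≡ blocks i (window g i n)
  concat-blocks g h i zero _ = refl
  concat-blocks g h i (suc n) h≗ rewrite h≗ 0 | +-identityʳ i =
    cong (block i (g i) ++_) (concat-blocks g (h ∘ suc) (suc i) n (λ m → trans (h≗ (suc m)) (+-suc i m)))

φCat≡φSpine : ∀ ys → φCat ys ≡ φSpine (pendants ys)
φCat≡φSpine ys =
  trans (cong (λ V → φ V (catAdj ys)) (catVerts≡blocks ys)) (φSpine-count ys 0 (pendants ys))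

module _ (ys : List ℕ) where

  private
    Z : List ℕ
    Z = pendants ys

    length-Z : ∀ X W → Z ≡ X ++ W → length X + length W ≡ length Z
    length-Z X W Z≡ = trans (sym (length-++ X)) (cong length (sym Z≡))

  fV-pendant : ∀ x X y W → Z ≡ (x ∷ X) ++ y ∷ W → fV ys (suc (length X)) ≡ 2 ^ y * 1
  fV-pendant x X y W Z≡ =
    trans (fComp≡countB-blocks j (≡ᵇ-refl j) j< (catVerts≡blocks ys) (x ∷ X) (y ∷ []) W Z≡
             (λ m m< → ≢⇒≡ᵇ-false m j (<⇒≢ m<))
             (λ m j≤m m< → subst (λ x → (x ≡ᵇ j) ≡ true)
                              (≤-antisym j≤m (≤-pred (subst (m <_) (+-comm j 1) m<))) (≡ᵇ-refl j))
             (λ m j<m _ → ≢⇒≡ᵇ-false m j (>⇒≢ (subst (_≤ m) (+-comm j 1) j<m))))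
          (fFirst-count ys j (y ∷ []))
    where
    j : ℕ
    j = suc (length X)
    C : ℕ → Bool
    C m = m ≡ᵇ j
    convex : ∀ a m b → C a ≡ true → C b ≡ true → a ≤ m → m ≤ b → C m ≡ true
    convex a m b a≡ b≡ a≤m m≤b =
      subst (λ x → (x ≡ᵇ j) ≡ true)
        (≤-antisym (subst (_≤ m) (≡ᵇ-true⇒≡ a j a≡) a≤m) (subst (m ≤_) (≡ᵇ-true⇒≡ b j b≡) m≤b))
        (≡ᵇ-refl j)
    es : List (Vtx × Vtx)
    es = (sp (length X) , sp j) ∷ (sp j , sp (suc j)) ∷ []
    leave : ∀ a b → (a , b) ∈ es → C (pos a) ≡ false ⊎ C (pos b) ≡ false
    leave a b (here refl) = inj₁ (≢⇒≡ᵇ-false (length X) j (<⇒≢ ≤-refl))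
    leave a b (there (here refl)) = inj₂ (≢⇒≡ᵇ-false (suc j) j (>⇒≢ ≤-refl))
    cut : ∀ a b → C a ≡ true → C b ≡ false → suc a ≡ b ⊎ suc b ≡ a →
          ((a , 0) , (b , 0)) ∈ es ⊎ ((b , 0) , (a , 0)) ∈ es
    cut a b a≡ _ adjacent with ≡ᵇ-true⇒≡ a j a≡
    cut a b a≡ _ (inj₁ refl) | refl = inj₁ (there (here refl))
    cut a b a≡ _ (inj₂ refl) | refl = inj₂ (here refl)
    open Component ys es C convex leave cut 0 (ys ++ 0 ∷ [])
    j< : j < length Z
    j< = subst (j <_) (length-Z (x ∷ X) (y ∷ W) Z≡) (s≤s (m<m+n (length X) (s≤s z≤n)))

  fV≥-pendant : ∀ x X y W → Z ≡ (x ∷ X) ++ y ∷ W → fV≥ ys (suc (length X)) ≡ fFirst (y ∷ W)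
  fV≥-pendant x X y W Z≡ =
    trans (fComp≡countB-blocks j (≤ᵇ-true⁺ j j ≤-refl) j< (catVerts≡blocks ys) (x ∷ X) (y ∷ W) []
             (trans Z≡ (cong ((x ∷ X) ++_) (sym (++-identityʳ (y ∷ W)))))
             (λ m m< → ≤ᵇ-false⁺ j m m<) (λ m j≤m _ → ≤ᵇ-true⁺ j m j≤m)
             (λ m end≤m m< → ⊥-elim (<⇒≱ (subst (m <_) (+-identityʳ _) m<) end≤m)))
          (fFirst-count ys j (y ∷ W))
    where
    j : ℕ
    j = suc (length X)
    C : ℕ → Bool
    C m = j ≤ᵇ m
    convex : ∀ a m b → C a ≡ true → C b ≡ true → a ≤ m → m ≤ b → C m ≡ true
    convex a m b a∈C _ a≤m _ = ≤ᵇ-true⁺ j m (≤-trans (≤ᵇ-true⁻ j a a∈C) a≤m)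
    es : List (Vtx × Vtx)
    es = (sp (length X) , sp j) ∷ []
    leave : ∀ a b → (a , b) ∈ es → C (pos a) ≡ false ⊎ C (pos b) ≡ false
    leave a b (here refl) = inj₁ (≤ᵇ-false⁺ j (length X) ≤-refl)
    cut : ∀ a b → C a ≡ true → C b ≡ false → suc a ≡ b ⊎ suc b ≡ a →
          ((a , 0) , (b , 0)) ∈ es ⊎ ((b , 0) , (a , 0)) ∈ es
    cut a b a∈C b∉C (inj₁ refl) = ⊥-elim (<-asym (≤ᵇ-false⁻ j b b∉C) (s≤s (≤ᵇ-true⁻ j a a∈C)))
    cut a b a∈C b∉C (inj₂ refl) with ≤-antisym (≤ᵇ-false⁻ j b b∉C) (≤ᵇ-true⁻ j a a∈C)
    ... | refl = inj₂ (here refl)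
    open Component ys es C convex leave cut 0 (ys ++ 0 ∷ [])
    j< : j < length Z
    j< = subst (j <_) (length-Z (x ∷ X) (y ∷ W) Z≡) (s≤s (m<m+n (length X) (s≤s z≤n)))

  fV≤-pendant : ∀ x X W → Z ≡ (x ∷ X) ++ W → fV≤ ys (length X) ≡ fLast (x ∷ X)
  fV≤-pendant x X W Z≡ =
    trans (fComp≡countB-blocks j (≤ᵇ-true⁺ j j ≤-refl) j< (catVerts≡blocks ys) [] (x ∷ X) W Z≡
             (λ _ ()) (λ m _ m< → ≤ᵇ-true⁺ m j (≤-pred m<)) (λ m x∷X≤m _ → ≤ᵇ-false⁺ m j x∷X≤m))
          (fLast-count ys 0 x X)
    where
    j : ℕ
    j = length X
    C : ℕ → Bool
    C m = m ≤ᵇ j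
    convex : ∀ a m b → C a ≡ true → C b ≡ true → a ≤ m → m ≤ b → C m ≡ true
    convex a m b _ b∈C _ m≤b = ≤ᵇ-true⁺ m j (≤-trans m≤b (≤ᵇ-true⁻ b j b∈C))
    es : List (Vtx × Vtx)
    es = (sp j , sp (suc j)) ∷ []
    leave : ∀ a b → (a , b) ∈ es → C (pos a) ≡ false ⊎ C (pos b) ≡ false
    leave a b (here refl) = inj₂ (≤ᵇ-false⁺ (suc j) j ≤-refl)
    cut : ∀ a b → C a ≡ true → C b ≡ false → suc a ≡ b ⊎ suc b ≡ a →
          ((a , 0) , (b , 0)) ∈ es ⊎ ((b , 0) , (a , 0)) ∈ es
    cut a b a∈C b∉C (inj₂ refl) = ⊥-elim (<-asym (≤ᵇ-false⁻ b j b∉C) (≤ᵇ-true⁻ a j a∈C))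
    cut a b a∈C b∉C (inj₁ refl) with ≤-antisym (≤ᵇ-true⁻ a j a∈C) (≤-pred (≤ᵇ-false⁻ b j b∉C))
    ... | refl = inj₁ (here refl)
    open Component ys es C convex leave cut 0 (ys ++ 0 ∷ [])
    j< : j < length Z
    j< = subst (j <_) (length-Z (x ∷ X) W Z≡) (s≤s (m≤m+n (length X) (length W)))

fV≡2^yAt : ∀ ys j → 1 ≤ j → j ≤ length ys → fV ys j ≡ 2 ^ yAt ys j * 1
fV≡2^yAt ys (suc j) _ j<k with m≤n⇒∃[o]m+o≡n j<k
... | m , j+1+m≡k =
  subst (λ n → fV ys (suc n) ≡ 2 ^ g (suc j) * 1) (length-window g 1 j)
    (fV-pendant ys (g 0) (window g 1 j) (g (suc j)) (window g (2 + j) (suc m)) split)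
  where
  g : ℕ → ℕ
  g = yAt ys
  split : pendants ys ≡ (g 0 ∷ window g 1 j) ++ g (suc j) ∷ window g (2 + j) (suc m)
  split = trans (sym (window-yAt-pendants ys))
    (trans (cong (λ n → window g 0 (2 + n)) (sym j+1+m≡k))
      (trans (cong (window g 0) (arith j m)) (window-++ g 0 (suc j) (suc (suc m)))))
    where
    arith : ∀ j m → 2 + (suc j + m) ≡ suc j + suc (suc m)
    arith = solve-∀

-- Algebra of the subtree counts

fSpan-++ : ∀ X Y → fSpan (X ++ Y) ≡ fSpan X * fSpan Y
fSpan-++ [] Y = sym (+-identityʳ _)
fSpan-++ (z ∷ X) Y rewrite fSpan-++ X Y = sym (*-assoc (2 ^ z) (fSpan X) (fSpan Y))

fFirst-++ : ∀ X Y → fFirst (X ++ Y) ≡ fFirst X + fSpan X * fFirst Y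
fFirst-++ [] Y = sym (+-identityʳ _)
fFirst-++ (z ∷ X) Y rewrite fFirst-++ X Y = ring (2 ^ z) (fFirst X) (fSpan X) (fFirst Y)
  where
  ring : ∀ w f s f′ → w * suc (f + s * f′) ≡ w * suc f + w * s * f′
  ring = solve-∀

fLast-++ : ∀ X Y → fLast (X ++ Y) ≡ fLast Y + fSpan Y * fLast X
fLast-++ [] Y = sym (trans (cong (fLast Y +_) (*-zeroʳ (fSpan Y))) (+-identityʳ _))
fLast-++ (z ∷ X) Y rewrite fSpan-++ X Y | fLast-++ X Y = ring (2 ^ z) (fSpan X) (fSpan Y) (fLast Y) (fLast X)
  where
  ring : ∀ w s s′ l′ l → w * (s * s′) + (l′ + s′ * l) ≡ l′ + s′ * (w * s + l)
  ring = solve-∀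

φSpine-++ : ∀ X Y → φSpine (X ++ Y) ≡ φSpine X + φSpine Y + fLast X * fFirst Y
φSpine-++ [] Y = sym (+-identityʳ _)
φSpine-++ (z ∷ X) Y rewrite fFirst-++ X Y | φSpine-++ X Y =
  ring (2 ^ z) z (fFirst X) (fSpan X) (fFirst Y) (φSpine X) (φSpine Y) (fLast X)
  where
  ring : ∀ w z f s f′ φ φ′ l →
    w * suc (f + s * f′) + (z + (φ + φ′ + l * f′)) ≡ w * suc f + (z + φ) + φ′ + (w * s + l) * f′
  ring = solve-∀

fSpan-reverse : ∀ X → fSpan (reverse X) ≡ fSpan X
fSpan-reverse [] = refl
fSpan-reverse (z ∷ X) rewrite unfold-reverse z X | fSpan-++ (reverse X) (z ∷ []) | fSpan-reverse X =
  trans (cong (fSpan X *_) (*-identityʳ (2 ^ z))) (*-comm (fSpan X) (2 ^ z))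

fFirst-reverse : ∀ X → fFirst (reverse X) ≡ fLast X
fFirst-reverse [] = refl
fFirst-reverse (z ∷ X) rewrite unfold-reverse z X | fFirst-++ (reverse X) (z ∷ [])
  | fFirst-reverse X | fSpan-reverse X = ring (2 ^ z) (fLast X) (fSpan X)
  where
  ring : ∀ w l s → l + s * (w * 1) ≡ w * s + l
  ring = solve-∀

fLast-reverse : ∀ X → fLast (reverse X) ≡ fFirst X
fLast-reverse X = trans (sym (fFirst-reverse (reverse X))) (cong fFirst (reverse-involutive X))

φSpine-reverse : ∀ X → φSpine (reverse X) ≡ φSpine X
φSpine-reverse [] = refl
φSpine-reverse (z ∷ X) rewrite unfold-reverse z X | φSpine-++ (reverse X) (z ∷ [])
  | φSpine-reverse X | fLast-reverse X = ring (2 ^ z) z (φSpine X) (fFirst X)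
  where
  ring : ∀ w z φ f → φ + (w * 1 + (z + 0)) + f * (w * 1) ≡ w * suc f + (z + φ)
  ring = solve-∀

rearrangement : ∀ a b c d → a < b → c < d → a * d + b * c < a * c + b * d
rearrangement a b c d a<b c<d with m≤n⇒∃[o]m+o≡n a<b | m≤n⇒∃[o]m+o≡n c<d
... | e , refl | f , refl = subst (a * (suc c + f) + (suc a + e) * c <_) (sym (ring a c e f)) (s≤s (m≤m+n _ _))
  where
  ring : ∀ a c e f → a * c + (suc a + e) * (suc c + f) ≡
                     suc (a * (suc c + f) + (suc a + e) * c + (e + f + e * f))
  ring = solve-∀

φSpine-++-++ : ∀ P M Q → φSpine (P ++ M ++ Q) ≡
  (φSpine P + φSpine M + φSpine Q + fLast P * (fSpan M * fFirst Q)) + (fFirst Q * fLast M + fLast P * fFirst M)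
φSpine-++-++ P M Q rewrite φSpine-++ P (M ++ Q) | φSpine-++ M Q | fFirst-++ M Q =
  ring (φSpine P) (φSpine M) (φSpine Q) (fLast P) (fLast M) (fFirst M) (fSpan M) (fFirst Q)
  where
  ring : ∀ φP φM φQ lP lM fM sM fQ →
    φP + (φM + φQ + lM * fQ) + lP * (fM + sM * fQ) ≡ (φP + φM + φQ + lP * (sM * fQ)) + (fQ * lM + lP * fM)
  ring = solve-∀

-- The gain is (fLast P − fFirst Q) (fFirst M − fLast M): the rearrangement inequality.
φSpine-reverse-middle : ∀ P M Q → fFirst Q < fLast P → fLast M < fFirst M →
  φSpine (P ++ reverse M ++ Q) < φSpine (P ++ M ++ Q)
φSpine-reverse-middle P M Q Q<P M<M = begin-strict
  φSpine (P ++ reverse M ++ Q)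
    ≡⟨ φSpine-++-++ P (reverse M) Q ⟩
  (φSpine P + φSpine (reverse M) + φSpine Q + fLast P * (fSpan (reverse M) * fFirst Q))
    + (fFirst Q * fLast (reverse M) + fLast P * fFirst (reverse M))
    ≡⟨ cong₂ (λ φM sM → (φSpine P + φM + φSpine Q + fLast P * (sM * fFirst Q)) + cross)
             (φSpine-reverse M) (fSpan-reverse M) ⟩
  rest + cross
    ≡⟨ cong₂ (λ l f → rest + (fFirst Q * l + fLast P * f)) (fLast-reverse M) (fFirst-reverse M) ⟩
  rest + (fFirst Q * fFirst M + fLast P * fLast M)
    <⟨ +-monoʳ-< rest (rearrangement (fFirst Q) (fLast P) (fLast M) (fFirst M) Q<P M<M) ⟩
  rest + (fFirst Q * fLast M + fLast P * fFirst M)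
    ≡⟨ sym (φSpine-++-++ P M Q) ⟩
  φSpine (P ++ M ++ Q) ∎
  where
  open ≤-Reasoning
  rest : ℕ
  rest = φSpine P + φSpine M + φSpine Q + fLast P * (fSpan M * fFirst Q)
  cross : ℕ
  cross = fFirst Q * fLast (reverse M) + fLast P * fFirst (reverse M)

private
  fFirst-wrap : ∀ a N b → fFirst (a ∷ N ++ b ∷ []) ≡ 2 ^ a * fSpan N * 2 ^ b + (2 ^ a + 2 ^ a * fFirst N)
  fFirst-wrap a N b rewrite fFirst-++ N (b ∷ []) = ring (2 ^ a) (2 ^ b) (fSpan N) (fFirst N)
    where
    ring : ∀ A B s f → A * suc (f + s * (B * 1)) ≡ A * s * B + (A + A * f)
    ring = solve-∀

  fLast-wrap : ∀ a N b → fLast (a ∷ N ++ b ∷ []) ≡ 2 ^ a * fSpan N * 2 ^ b + (2 ^ b + 2 ^ b * fLast N)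
  fLast-wrap a N b rewrite fSpan-++ N (b ∷ []) | fLast-++ N (b ∷ []) = ring (2 ^ a) (2 ^ b) (fSpan N) (fLast N)
    where
    ring : ∀ A B s l → A * (s * (B * 1)) + (B * 1 + 0 + B * 1 * l) ≡ A * s * B + (B + B * l)
    ring = solve-∀

fLast≤fFirst-wrap : ∀ a N b → 2 ^ b ≤ 2 ^ a → fLast N ≤ fFirst N →
  fLast (a ∷ N ++ b ∷ []) ≤ fFirst (a ∷ N ++ b ∷ [])
fLast≤fFirst-wrap a N b b≤a N≤ rewrite fLast-wrap a N b | fFirst-wrap a N b =
  +-monoʳ-≤ (2 ^ a * fSpan N * 2 ^ b) (+-mono-≤ b≤a (*-mono-≤ b≤a N≤))

fLast<fFirst-wrap : ∀ a N b → 2 ^ b ≤ 2 ^ a → fLast N ≤ fFirst N →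
  2 ^ b < 2 ^ a ⊎ fLast N < fFirst N → fLast (a ∷ N ++ b ∷ []) < fFirst (a ∷ N ++ b ∷ [])
fLast<fFirst-wrap a N b b≤a N≤ strict rewrite fLast-wrap a N b | fFirst-wrap a N b =
  +-monoʳ-< (2 ^ a * fSpan N * 2 ^ b) (ends strict)
  where
  ends : 2 ^ b < 2 ^ a ⊎ fLast N < fFirst N → 2 ^ b + 2 ^ b * fLast N < 2 ^ a + 2 ^ a * fFirst N
  ends (inj₁ b<a) = +-mono-<-≤ b<a (*-mono-≤ b≤a N≤)
  ends (inj₂ N<) =
    +-mono-≤-< b≤a (≤-<-trans (*-monoˡ-≤ (fLast N) b≤a) (*-monoʳ-< (2 ^ a) {{m^n≢0 2 a}} N<))

-- The window g s (n + n) is symmetric about the gap between positions c and c + 1,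
-- pairing c ∸ i with c + i + 1.
fLast≤fFirst-nested : ∀ g c n s → s + n ≡ suc c →
  (∀ i → i < n → 2 ^ g (c + i + 1) ≤ 2 ^ g (c ∸ i)) →
  fLast (window g s (n + n)) ≤ fFirst (window g s (n + n)) ×
  (∃ (λ i → i < n × 2 ^ g (c + i + 1) < 2 ^ g (c ∸ i)) →
   fLast (window g s (n + n)) < fFirst (window g s (n + n)))
fLast≤fFirst-nested g c zero s _ _ = z≤n , λ { (_ , () , _) }
fLast≤fFirst-nested g c (suc n) s s+n≡ dominated =
  subst Goal (sym window-wrap) (wrap≤ , wrap<)
  where
  Goal : List ℕ → Set
  Goal W = fLast W ≤ fFirst W ×
           (∃ (λ i → i < suc n × 2 ^ g (c + i + 1) < 2 ^ g (c ∸ i)) → fLast W < fFirst W)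
  N : List ℕ
  N = window g (suc s) (n + n)
  b : ℕ
  b = g (suc s + (n + n))
  window-wrap : window g s (suc n + suc n) ≡ g s ∷ N ++ b ∷ []
  window-wrap = cong (g s ∷_) (trans (cong (window g (suc s)) (+-suc n n)) (window-∷ʳ g (suc s) (n + n)))
  s+n≡c : s + n ≡ c
  s+n≡c = suc-injective (trans (sym (+-suc s n)) s+n≡)
  inner : fLast N ≤ fFirst N × (∃ (λ i → i < n × 2 ^ g (c + i + 1) < 2 ^ g (c ∸ i)) → fLast N < fFirst N)
  inner = fLast≤fFirst-nested g c n (suc s) (trans (sym (+-suc s n)) s+n≡)
            (λ i i<n → dominated i (m<n⇒m<1+n i<n))
  outer-pair : ∀ {R : ℕ → ℕ → Set} → R (g (c + n + 1)) (g (c ∸ n)) → R b (g s)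
  outer-pair {R} = subst₂ R (cong g c+n+1≡) (cong g c∸n≡)
    where
    c∸n≡ : c ∸ n ≡ s
    c∸n≡ = trans (cong (_∸ n) (sym s+n≡c)) (m+n∸n≡m s n)
    c+n+1≡ : c + n + 1 ≡ suc s + (n + n)
    c+n+1≡ = trans (cong (λ x → x + n + 1) (sym s+n≡c)) (rearrange s n)
      where
      rearrange : ∀ s n → s + n + n + 1 ≡ suc s + (n + n)
      rearrange = solve-∀
  b≤ : 2 ^ b ≤ 2 ^ g s
  b≤ = outer-pair {λ x y → 2 ^ x ≤ 2 ^ y} (dominated n ≤-refl)
  wrap≤ : fLast (g s ∷ N ++ b ∷ []) ≤ fFirst (g s ∷ N ++ b ∷ [])
  wrap≤ = fLast≤fFirst-wrap (g s) N b b≤ (proj₁ inner)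
  wrap< : ∃ (λ i → i < suc n × 2 ^ g (c + i + 1) < 2 ^ g (c ∸ i)) →
          fLast (g s ∷ N ++ b ∷ []) < fFirst (g s ∷ N ++ b ∷ [])
  wrap< (i , i<1+n , strict) with m≤n⇒m<n∨m≡n (≤-pred i<1+n)
  ... | inj₁ i<n = fLast<fFirst-wrap (g s) N b b≤ (proj₁ inner) (inj₂ (proj₂ inner (i , i<n , strict)))
  ... | inj₂ refl =
    fLast<fFirst-wrap (g s) N b b≤ (proj₁ inner) (inj₁ (outer-pair {λ x y → 2 ^ x < 2 ^ y} strict))

-- Reversing the middle of the spine

-- With p = q + 1 + a and k = q + p + 1 + b, the spine v₀ … v_{k+1} of C(ys) is split into
-- P = v₀ … v_{p−q−1}, M = v_{p−q} … v_{p+q+1} and Q = v_{p+q+2} … v_{k+1}; ys₁ reverses M.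
module MiddleReversal (ys : List ℕ) (p q a b : ℕ)
  (p≡ : q + 1 + a ≡ p) (k≡ : q + p + 1 + b ≡ length ys) where

  length-ys : length ys ≡ a + (suc q + suc q) + b
  length-ys = trans (sym k≡) (trans (cong (λ p → q + p + 1 + b) (sym p≡)) (arith a q b))
    where
    arith : ∀ a q b → q + (q + 1 + a) + 1 + b ≡ a + (suc q + suc q) + b
    arith = solve-∀

  g : ℕ → ℕ
  g = yAt ys

  st : ℕ
  st = suc a + (suc q + suc q)

  P M Q : List ℕ
  P = window g 0 (suc a)
  M = window g (suc a) (suc q + suc q)
  Q = window g st (suc b)

  ys₁ : List ℕ
  ys₁ = window g 1 a ++ reverse M ++ window g st b

  ys-split : ys ≡ window g 1 a ++ M ++ window g st b
  ys-split = trans (sym (window-yAt ys))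
    (trans (cong (window g 1) (trans length-ys (+-assoc a _ b)))
      (trans (window-++ g 1 a _) (cong (window g 1 a ++_) (window-++ g (suc a) (suc q + suc q) b))))

  ys₁↭ys : ys₁ ↭ ys
  ys₁↭ys = subst (ys₁ ↭_) (sym ys-split) (++⁺ˡ (window g 1 a) (++⁺ʳ (window g st b) (↭-reverse M)))

  pendants-split : pendants ys ≡ P ++ M ++ Q
  pendants-split = trans (sym (window-yAt-pendants ys))
    (trans (cong (λ n → window g 0 (2 + n)) length-ys)
      (trans (cong (window g 0) (arith a q b))
        (trans (window-++ g 0 (suc a) _) (cong (P ++_) (window-++ g (suc a) (suc q + suc q) (suc b))))))
    where
    arith : ∀ a q b → 2 + (a + (suc q + suc q) + b) ≡ suc a + ((suc q + suc q) + suc b)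
    arith = solve-∀

  Q≡ : Q ≡ window g st b ++ 0 ∷ []
  Q≡ = trans (window-∷ʳ g st b)
    (cong (λ y → window g st b ++ y ∷ []) (trans (cong g st+b≡) (yAt-beyond ys)))
    where
    st+b≡ : st + b ≡ suc (length ys)
    st+b≡ = trans (+-assoc (suc a) _ b) (cong suc (sym (trans length-ys (+-assoc a _ b))))

  pendants₁-split : pendants ys₁ ≡ P ++ reverse M ++ Q
  pendants₁-split = cong (0 ∷_) (trans (++-assoc (window g 1 a) (reverse M ++ window g st b) (0 ∷ []))
    (cong (window g 1 a ++_) (trans (++-assoc (reverse M) (window g st b) (0 ∷ []))
      (cong (reverse M ++_) (sym Q≡)))))

  φCat-decreases : fFirst Q < fLast P → fLast M < fFirst M → φCat ys₁ < φCat ys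
  φCat-decreases Q<P M<M =
    subst₂ _<_ (sym (trans (φCat≡φSpine ys₁) (cong φSpine pendants₁-split)))
               (sym (trans (φCat≡φSpine ys) (cong φSpine pendants-split)))
               (φSpine-reverse-middle P M Q Q<P M<M)

  fV≥≡fFirst : fV≥ ys (p + q + 2) ≡ fFirst Q
  fV≥≡fFirst = trans (cong (λ p → fV≥ ys (p + q + 2)) (sym p≡)) (trans (cong (fV≥ ys) p+q+2≡)
    (fV≥-pendant ys (g 0) (window g 1 a ++ M) (g st) (window g (suc st) b)
       (trans pendants-split (cong (g 0 ∷_) (sym (++-assoc (window g 1 a) M Q))))))
    where
    arith : ∀ a q → q + 1 + a + q + 2 ≡ suc (a + (suc q + suc q))
    arith = solve-∀
    p+q+2≡ : q + 1 + a + q + 2 ≡ suc (length (window g 1 a ++ M))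
    p+q+2≡ = trans (arith a q) (cong suc (sym (trans (length-++ (window g 1 a))
               (cong₂ _+_ (length-window g 1 a) (length-window g (suc a) (suc q + suc q))))))

  fV≤≡fLast : fV≤ ys (p ∸ q ∸ 1) ≡ fLast P
  fV≤≡fLast = trans (cong (λ p → fV≤ ys (p ∸ q ∸ 1)) (sym p≡))
    (trans (cong (fV≤ ys) p∸q∸1≡) (fV≤-pendant ys (g 0) (window g 1 a) (M ++ Q) pendants-split))
    where
    p∸q∸1≡ : q + 1 + a ∸ q ∸ 1 ≡ length (window g 1 a)
    p∸q∸1≡ = trans (cong (_∸ 1) (trans (cong (_∸ q) (+-assoc q 1 a)) (m+n∸m≡n q (1 + a))))
                   (sym (length-window g 1 a))

  private
    p+q+1≤k : p + q + 1 ≤ length ys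
    p+q+1≤k = subst₂ _≤_ (cong (_+ 1) (+-comm q p)) k≡ (m≤m+n (q + p + 1) b)

    p≤k : p ≤ length ys
    p≤k = ≤-trans (m≤m+n p q) (≤-trans (m≤m+n (p + q) 1) p+q+1≤k)

    q<p : q < p
    q<p = ≤-trans (≤-reflexive (+-comm 1 q)) (subst (q + 1 ≤_) p≡ (m≤m+n (q + 1) a))

    fV-right : ∀ i → i ≤ q → fV ys (p + i + 1) ≡ 2 ^ g (p + i + 1)
    fV-right i i≤q = trans (fV≡2^yAt ys (p + i + 1) (m≤n+m 1 (p + i))
                             (≤-trans (+-monoˡ-≤ 1 (+-monoʳ-≤ p i≤q)) p+q+1≤k))
                           (*-identityʳ _)

    fV-left : ∀ i → i ≤ q → fV ys (p ∸ i) ≡ 2 ^ g (p ∸ i)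
    fV-left i i≤q = trans (fV≡2^yAt ys (p ∸ i) (m<n⇒0<n∸m (≤-<-trans i≤q q<p)) (≤-trans (m∸n≤m p i) p≤k))
                          (*-identityʳ _)

  fLast<fFirst-M : (∀ i → i ≤ q → fV ys (p + i + 1) ≤ fV ys (p ∸ i)) →
    ∃ (λ i → i ≤ q × fV ys (p + i + 1) < fV ys (p ∸ i)) → fLast M < fFirst M
  fLast<fFirst-M dominated (i , i≤q , strict) =
    proj₂ (fLast≤fFirst-nested g p (suc q) (suc a) (trans (arith a q) (cong suc p≡)) pairs)
          (i , s≤s i≤q , subst₂ _<_ (fV-right i i≤q) (fV-left i i≤q) strict)
    where
    arith : ∀ a q → suc a + suc q ≡ suc (q + 1 + a)
    arith = solve-∀
    pairs : ∀ i → i < suc q → 2 ^ g (p + i + 1) ≤ 2 ^ g (p ∸ i)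
    pairs i i<1+q = let i≤q = ≤-pred i<1+q in
      subst₂ _≤_ (fV-right i i≤q) (fV-left i i≤q) (dominated i i≤q)

lemma3p2 : (k : ℕ) (ds ys : List ℕ)
    → length ds ≡ k
    → Linked (λ a b → b ≤ a) ds
    → All (2 ≤_) ds
    → ys ↭ map (_∸ 2) ds
    → (p q : ℕ)
    → 1 ≤ p → p + 1 ≤ k
    → q + p + 1 ≤ k → q + 1 ≤ p
    → (∀ i → i ≤ q → fV ys (p + i + 1) ≤ fV ys (p ∸ i))
    → ∃ (λ i → i ≤ q × fV ys (p + i + 1) < fV ys (p ∸ i))
    → fV≥ ys (p + q + 2) < fV≤ ys (p ∸ q ∸ 1)
    → ∃ (λ ys₁ → ys₁ ↭ map (_∸ 2) ds × φCat ys₁ < φCat ys)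
lemma3p2 k ds ys refl _ _ ys↭ds p q _ _ q+p+1≤k q+1≤p dominated strict ends =
  let a , p≡ = m≤n⇒∃[o]m+o≡n q+1≤p
      b , k≡ = m≤n⇒∃[o]m+o≡n q+p+1≤k
      open MiddleReversal ys p q a b p≡ (trans k≡ (sym (trans (↭-length ys↭ds) (length-map (_∸ 2) ds))))
  in ys₁ , ↭-trans ys₁↭ys ys↭ds ,
     φCat-decreases (subst₂ _<_ fV≥≡fFirst fV≤≡fLast ends) (fLast<fFirst-M dominated strict)
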